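{- Let $n\ge 2$ and let $\Sigma=(\sigma_0,\sigma_\infty,\sigma_1,\tau)$ be a special 4-tuple such that the disjoint cycle decomposition of $\sigma_1\tau$ contains a 3-cycle. Then there exist integers $h,k$ with $1\le h\le n-2$, $h<k<2n-h$ and $h\equiv k\pmod 2$ such that $$\sigma_0=\prod_{i=1}^{h}(i,2n+1-i)\prod_{j=1}^{\frac{k-h}{2}}(h+j,k+1-j)\prod_{t=1}^{\frac{2n-h-k}{2}}(k+t,2n-h+1-t),$$ $$\sigma_1\tau=\prod_{i=1}^{h-1}(i,2n-i)\prod_{j=1}^{\frac{k-h}{2}-1}(h+j,k-j)\prod_{t=1}^{\frac{2n-h-k}{2}}(k+t,2n-h-t)\,(2n-h,h,k).$$ In particular $\sigma_1\tau$ fixes exactly the three indices $2n$, $\frac{k+h}{2}$ and $\frac{2n-h+k}{2}$. Moreover, for such $h,k$ there are three different special 4-tuples with $\sigma_0$ and $\sigma_1\tau$ of this form, corresponding to the choices $\tau\in\{(h,k),(h,2n-h),(k,2n-h)\}$.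
   Context: A special 4-tuple is $\Sigma=(\sigma_0,\sigma_\infty,\sigma_1,\tau)\in S_{2n}^4$ such that: $\sigma_0$ is a product of $n$ disjoint transpositions; $\sigma_\infty=(2n,2n-1,\dots,1)$; $\sigma_1$ is a product of $n-1$ disjoint transpositions; $\tau$ is a transposition; $\sigma_0\sigma_\infty\sigma_1\tau=\mathrm{id}$, where products of permutations are composed from left to right (the leftmost factor is applied first); and $\sigma_1(2n)=\tau(2n)=2n$. (These are the normalized monodromy tuples of $A^2$ for solutions $(A,B)$ of degree $n$ of $A^2-DB^2=1$ with $D$ squarefree of degree $4$ and $A^2$ having four branch points $0,1,\infty,b$.) Cycle notation $(a_1,\dots,a_r)$ means $a_1\mapsto a_2\mapsto\dots\mapsto a_r\mapsto a_1$. -}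

module Defs where

open import Data.Nat using (ℕ; zero; suc; _+_; _*_; _∸_; _≤_; _<_; _≟_)
open import Data.Nat.DivMod using (_/_; _%_)
open import Data.Fin using (Fin; toℕ)
open import Data.Fin.Permutation using (Permutation′; _⟨$⟩ʳ_)
open import Data.List using (List; []; _∷_; _++_; map; length; concatMap; upTo)
open import Data.List.Relation.Unary.All using (All)
open import Data.List.Relation.Unary.Unique.Propositional using (Unique)
open import Data.Product using (Σ; _×_; _,_; proj₁; proj₂; ∃-syntax)
open import Relation.Binary.PropositionalEquality using (_≡_; _≢_)
open import Relation.Nullary using (yes; no)

-- Points of S_m are Fin m; the point x is the index  label x = toℕ x + 1 ∈ {1,…,m}.
label : ∀ {m} → Fin m → ℕ
label x = suc (toℕ x)

swapℕ : ℕ → ℕ → ℕ → ℕ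
swapℕ a b x with x ≟ a | x ≟ b
... | yes _ | _     = b
... | no _  | yes _ = a
... | no _  | no _  = x

-- Product of transpositions, composed left to right (first pair applied first).
prodT : List (ℕ × ℕ) → ℕ → ℕ
prodT []             x = x
prodT ((a , b) ∷ ps) x = prodT ps (swapℕ a b x)

cyc3 : ℕ → ℕ → ℕ → ℕ → ℕ
cyc3 a b c x with x ≟ a | x ≟ b | x ≟ c
... | yes _ | _     | _     = b
... | no _  | yes _ | _     = c
... | no _  | no _  | yes _ = a
... | no _  | no _  | no _  = x

Represents : ∀ {m} → (Fin m → Fin m) → (ℕ → ℕ) → Set
Represents σ f = ∀ x → label (σ x) ≡ f (label x)

entries : List (ℕ × ℕ) → List ℕ
entries = concatMap (λ p → proj₁ p ∷ proj₂ p ∷ [])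

IsProdDisjTransp : ∀ m → ℕ → Permutation′ m → Set
IsProdDisjTransp m r σ =
  Σ (List (ℕ × ℕ)) λ ps →
    length ps ≡ r
    × All (λ a → 1 ≤ a × a ≤ m) (entries ps)
    × Unique (entries ps)
    × Represents (σ ⟨$⟩ʳ_) (prodT ps)

-- σ∞ = (m, m-1, …, 1) on indices: i ↦ i-1 for i ≥ 2, 1 ↦ m.
rot : ℕ → ℕ → ℕ
rot m zero          = zero
rot m (suc zero)    = m
rot m (suc (suc j)) = suc j

record Special (n : ℕ) : Set where
  field
    σ₀ σ∞ σ₁ τ : Permutation′ (2 * n)
    σ₀-type   : IsProdDisjTransp (2 * n) n σ₀
    σ∞-def    : Represents (σ∞ ⟨$⟩ʳ_) (rot (2 * n))
    σ₁-type   : IsProdDisjTransp (2 * n) (n ∸ 2) σ₁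
    τ-type    : IsProdDisjTransp (2 * n) 1 τ
    -- σ₀σ∞σ₁τ = id, composed left to right
    relation  : ∀ x → τ ⟨$⟩ʳ (σ₁ ⟨$⟩ʳ (σ∞ ⟨$⟩ʳ (σ₀ ⟨$⟩ʳ x))) ≡ x
    σ₁-fix    : ∀ x → label x ≡ 2 * n → label (σ₁ ⟨$⟩ʳ x) ≡ 2 * n
    τ-fix     : ∀ x → label x ≡ 2 * n → label (τ ⟨$⟩ʳ x) ≡ 2 * n

-- σ₁τ (left to right: first σ₁, then τ)
σ₁τ : ∀ {n} → Special n → Fin (2 * n) → Fin (2 * n)
σ₁τ S x = Special.τ S ⟨$⟩ʳ (Special.σ₁ S ⟨$⟩ʳ x)

Has3Cycle : ∀ {m} → (Fin m → Fin m) → Set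
Has3Cycle {m} f = ∃[ a ] ∃[ b ] ∃[ c ]
  (a ≢ b × b ≢ c × a ≢ c × f a ≡ b × f b ≡ c × f c ≡ a)

range1 : ℕ → List ℕ
range1 N = map suc (upTo N)

Admissible : ℕ → ℕ → ℕ → Set
Admissible n h k =
  1 ≤ h × h ≤ n ∸ 2 × h < k × k < 2 * n ∸ h × h % 2 ≡ k % 2

σ₀Pairs : ℕ → ℕ → ℕ → List (ℕ × ℕ)
σ₀Pairs n h k =
     map (λ i → i , (2 * n + 1) ∸ i) (range1 h)
  ++ map (λ j → h + j , (k + 1) ∸ j) (range1 ((k ∸ h) / 2))
  ++ map (λ t → k + t , ((2 * n ∸ h) + 1) ∸ t) (range1 ((2 * n ∸ h ∸ k) / 2))

ρPairs : ℕ → ℕ → ℕ → List (ℕ × ℕ)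
ρPairs n h k =
     map (λ i → i , 2 * n ∸ i) (range1 (h ∸ 1))
  ++ map (λ j → h + j , k ∸ j) (range1 ((k ∸ h) / 2 ∸ 1))
  ++ map (λ t → k + t , (2 * n ∸ h) ∸ t) (range1 ((2 * n ∸ h ∸ k) / 2))

ρFun : ℕ → ℕ → ℕ → ℕ → ℕ
ρFun n h k x = cyc3 (2 * n ∸ h) h k (prodT (ρPairs n h k) x)

-- Read σ₀ and r = σ₁τ as maps on the labels 1, …, N = 2n.  The relation σ₀σ∞σ₁τ = id says
-- r(w) = σ₀(w + 1) (mod N), so a chord {w + 1, z} of the fixed-point-free involution σ₀ with
-- r²(w) = w forces the chord {w, z + 1}.  As σ₁ is an involution and τ a transposition, r² moves
-- at most four points, so r² is the identity off the 3-cycle (e h k) of r.  Taking e to be the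
-- largest point of the cycle, the chord {N, 1} propagates through (e, N] and gives h = N − e as
-- r(e); the chords {h + 1, k} and {k + 1, e} forced by the cycle propagate through (h, k) and
-- (k, e), and fixed-point-freeness makes both of these arcs even.  This pins down σ₀ and σ₁τ.
-- Conversely, for such h and k the three ways of writing (e h k) as a product of two
-- transpositions give the three special 4-tuples.

module Submission where

open import Defs
open import Data.Empty using (⊥; ⊥-elim)
open import Data.Fin using (Fin; fromℕ<)
open import Data.Fin.Permutation using (Permutation′; _⟨$⟩ʳ_; permutation)
open import Data.Fin.Properties using (toℕ-fromℕ<; toℕ<n; toℕ-injective)
open import Data.List using (List; []; _∷_; _++_; map; length; upTo)
open import Data.List.Membership.Propositional using (_∈_; _∉_)
open import Data.List.Membership.Propositional.Properties
  using (∈-∃++; ∈-++⁻; ∈-++⁺ˡ; ∈-++⁺ʳ; ∈-map⁺; ∈-map⁻; ∈-upTo⁺; ∈-upTo⁻)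
open import Data.List.Properties
  using (concatMap-++; length-++-sucʳ; length-++; length-map; length-upTo; map-++; upTo-∷ʳ; ++-assoc)
open import Data.List.Relation.Binary.Subset.Propositional using (_⊆_)
open import Data.List.Relation.Unary.All as All using (All; []; _∷_)
open import Data.List.Relation.Unary.All.Properties using (All¬⇒¬Any; ¬Any⇒All¬)
open import Data.List.Relation.Unary.Any using (here; there)
open import Data.List.Relation.Unary.Unique.Propositional using (Unique; []; _∷_)
import Data.List.Relation.Unary.Unique.Propositional.Properties as Unique
open import Data.Nat using (ℕ; zero; suc; _+_; _*_; _∸_; _⊔_; _≤_; _<_; _≟_; _≤?_; _<?_; s≤s; z≤n; z<s)
open import Data.List.Membership.DecPropositional _≟_ using (_∈?_)
open import Data.Nat.DivMod using (_/_; _%_; m*n/n≡m; [m+kn]%n≡m%n; [m+n]%n≡m%n)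
open import Data.Nat.Properties
open import Data.Nat.Tactic.RingSolver using (solve-∀)
open import Data.Product using (Σ; _×_; _,_; proj₁; proj₂; ∃-syntax)
open import Data.Sum using (_⊎_; inj₁; inj₂; [_,_]′) renaming (swap to ⊎-swap)
open import Function using (_∘′_)
open import Function.Bundles using (_⇔_; mk⇔; Equivalence)
open import Relation.Binary.Definitions using (Tri; tri<; tri≈; tri>)
open import Relation.Binary.PropositionalEquality
open import Relation.Nullary using (¬_; yes; no)

-- Transpositions and their products

swapℕ-left : ∀ a b → swapℕ a b a ≡ b
swapℕ-left a b with a ≟ a
... | yes _ = refl
... | no a≢a = ⊥-elim (a≢a refl)

swapℕ-right : ∀ a b → swapℕ a b b ≡ a
swapℕ-right a b with b ≟ a | b ≟ b
... | yes b≡a | _ = b≡a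
... | no _ | yes _ = refl
... | no _ | no b≢b = ⊥-elim (b≢b refl)

swapℕ-fixes : ∀ {a b x} → x ≢ a → x ≢ b → swapℕ a b x ≡ x
swapℕ-fixes {a} {b} {x} x≢a x≢b with x ≟ a | x ≟ b
... | yes x≡a | _ = ⊥-elim (x≢a x≡a)
... | no _ | yes x≡b = ⊥-elim (x≢b x≡b)
... | no _ | no _ = refl

swapℕ-self : ∀ a x → swapℕ a a x ≡ x
swapℕ-self a x with x ≟ a
... | yes x≡a = sym x≡a
... | no _ = refl

swapℕ-involutive : ∀ a b x → swapℕ a b (swapℕ a b x) ≡ x
swapℕ-involutive a b x with x ≟ a | x ≟ b
... | yes refl | _ = swapℕ-right x b
... | no _ | yes refl = swapℕ-left a x
... | no x≢a | no x≢b = swapℕ-fixes x≢a x≢b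

prodT-++ : ∀ xs ys x → prodT (xs ++ ys) x ≡ prodT ys (prodT xs x)
prodT-++ [] ys x = refl
prodT-++ ((a , b) ∷ xs) ys x = prodT-++ xs ys (swapℕ a b x)

prodT-drop-trivial : ∀ xs x y → prodT (xs ++ (x , x) ∷ []) y ≡ prodT xs y
prodT-drop-trivial xs x y = trans (prodT-++ xs _ y) (swapℕ-self x (prodT xs y))

entries-++ : ∀ xs ys → entries (xs ++ ys) ≡ entries xs ++ entries ys
entries-++ xs ys = concatMap-++ (λ p → proj₁ p ∷ proj₂ p ∷ []) xs ys

length-entries : ∀ ps → length (entries ps) ≡ 2 * length ps
length-entries [] = refl
length-entries (_ ∷ ps) = trans (cong (λ l → suc (suc l)) (length-entries ps)) (sym (*-suc 2 (length ps)))

∈-entries⁺ : ∀ {a b ps} → (a , b) ∈ ps ⊎ (b , a) ∈ ps → a ∈ entries ps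
∈-entries⁺ (inj₁ (here refl)) = here refl
∈-entries⁺ (inj₂ (here refl)) = there (here refl)
∈-entries⁺ {ps = _ ∷ _} (inj₁ (there p∈)) = there (there (∈-entries⁺ (inj₁ p∈)))
∈-entries⁺ {ps = _ ∷ _} (inj₂ (there p∈)) = there (there (∈-entries⁺ (inj₂ p∈)))

∈-entries⁻ : ∀ {x} ps → x ∈ entries ps → ∃[ y ] ((x , y) ∈ ps ⊎ (y , x) ∈ ps)
∈-entries⁻ ((a , b) ∷ ps) (here refl) = b , inj₁ (here refl)
∈-entries⁻ ((a , b) ∷ ps) (there (here refl)) = a , inj₂ (here refl)
∈-entries⁻ ((a , b) ∷ ps) (there (there x∈)) with ∈-entries⁻ ps x∈
... | y , inj₁ p∈ = y , inj₁ (there p∈)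
... | y , inj₂ p∈ = y , inj₂ (there p∈)

∈-entries-++⁻ : ∀ {x} xs ys → x ∈ entries (xs ++ ys) → x ∈ entries xs ⊎ x ∈ entries ys
∈-entries-++⁻ xs ys x∈ = ∈-++⁻ (entries xs) (subst (_ ∈_) (entries-++ xs ys) x∈)

prodT-fixes : ∀ {x} ps → x ∉ entries ps → prodT ps x ≡ x
prodT-fixes [] _ = refl
prodT-fixes ((a , b) ∷ ps) x∉ =
  trans (cong (prodT ps) (swapℕ-fixes (x∉ ∘′ here) (x∉ ∘′ there ∘′ here)))
        (prodT-fixes ps (x∉ ∘′ there ∘′ there))

swapℕ-head-fixes : ∀ {c d x} ps → Unique (entries ((c , d) ∷ ps)) → x ∈ entries ps → swapℕ c d x ≡ x
swapℕ-head-fixes ps (c∉ ∷ d∉ ∷ _) x∈ =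
  swapℕ-fixes (λ x≡c → All.lookup c∉ (there x∈) (sym x≡c)) (λ x≡d → All.lookup d∉ x∈ (sym x≡d))

prodT-partner : ∀ {a b} ps → Unique (entries ps) → (a , b) ∈ ps ⊎ (b , a) ∈ ps → prodT ps a ≡ b
prodT-partner ((a , b) ∷ ps) (_ ∷ b∉ ∷ _) (inj₁ (here refl)) =
  trans (cong (prodT ps) (swapℕ-left a b)) (prodT-fixes ps (All¬⇒¬Any b∉))
prodT-partner ((b , a) ∷ ps) (b∉ ∷ _ ∷ _) (inj₂ (here refl)) =
  trans (cong (prodT ps) (swapℕ-right b a)) (prodT-fixes ps (All¬⇒¬Any (All.tail b∉)))
prodT-partner (_ ∷ ps) u@(_ ∷ _ ∷ u′) (inj₁ (there p∈)) =
  trans (cong (prodT ps) (swapℕ-head-fixes ps u (∈-entries⁺ (inj₁ p∈)))) (prodT-partner ps u′ (inj₁ p∈))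
prodT-partner (_ ∷ ps) u@(_ ∷ _ ∷ u′) (inj₂ (there p∈)) =
  trans (cong (prodT ps) (swapℕ-head-fixes ps u (∈-entries⁺ (inj₂ p∈)))) (prodT-partner ps u′ (inj₂ p∈))

pair-distinct : ∀ {a b} ps → Unique (entries ps) → (a , b) ∈ ps → a ≢ b
pair-distinct (_ ∷ _) ((a≢b ∷ _) ∷ _) (here refl) = a≢b
pair-distinct (_ ∷ ps) (_ ∷ _ ∷ u) (there p∈) = pair-distinct ps u p∈

prodT-involutive : ∀ ps → Unique (entries ps) → ∀ x → prodT ps (prodT ps x) ≡ x
prodT-involutive ps u x with x ∈? entries ps
... | no x∉ = trans (cong (prodT ps) (prodT-fixes ps x∉)) (prodT-fixes ps x∉)
... | yes x∈ with ∈-entries⁻ ps x∈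
...   | y , pair = trans (cong (prodT ps) (prodT-partner ps u pair)) (prodT-partner ps u (⊎-swap pair))

prodT-moves : ∀ {x} ps → Unique (entries ps) → x ∈ entries ps → prodT ps x ≢ x
prodT-moves ps u x∈ with ∈-entries⁻ ps x∈
... | y , pair@(inj₁ p∈) = λ y≡x → pair-distinct ps u p∈ (trans (sym y≡x) (prodT-partner ps u pair))
... | y , pair@(inj₂ p∈) = λ y≡x → pair-distinct ps u p∈ (sym (trans (sym y≡x) (prodT-partner ps u pair)))

prodT-preserves : ∀ {P : ℕ → Set} {x} ps → Unique (entries ps) → All P (entries ps) → P x → P (prodT ps x)
prodT-preserves {P} {x} ps u all px with x ∈? entries ps
... | no x∉ = subst P (sym (prodT-fixes ps x∉)) px
... | yes x∈ with ∈-entries⁻ ps x∈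
...   | y , pair = subst P (sym (prodT-partner ps u pair)) (All.lookup all (∈-entries⁺ (⊎-swap pair)))

Unique-entries-++ : ∀ xs ys → Unique (entries xs) → Unique (entries ys) →
  (∀ {x} → x ∈ entries xs → x ∈ entries ys → ⊥) → Unique (entries (xs ++ ys))
Unique-entries-++ xs ys ux uy disjoint =
  subst Unique (sym (entries-++ xs ys)) (Unique.++⁺ ux uy (λ (x∈xs , x∈ys) → disjoint x∈xs x∈ys))

cyc3-first : ∀ a b c → cyc3 a b c a ≡ b
cyc3-first a b c with a ≟ a
... | yes _ = refl
... | no a≢a = ⊥-elim (a≢a refl)

cyc3-second : ∀ {a b c} → b ≢ a → cyc3 a b c b ≡ c
cyc3-second {a} {b} {c} b≢a with b ≟ a | b ≟ b
... | yes b≡a | _ = ⊥-elim (b≢a b≡a)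
... | no _ | yes _ = refl
... | no _ | no b≢b = ⊥-elim (b≢b refl)

cyc3-third : ∀ {a b c} → c ≢ a → c ≢ b → cyc3 a b c c ≡ a
cyc3-third {a} {b} {c} c≢a c≢b with c ≟ a | c ≟ b | c ≟ c
... | yes c≡a | _ | _ = ⊥-elim (c≢a c≡a)
... | no _ | yes c≡b | _ = ⊥-elim (c≢b c≡b)
... | no _ | no _ | yes _ = refl
... | no _ | no _ | no c≢c = ⊥-elim (c≢c refl)

cyc3-fixes : ∀ {a b c x} → x ≢ a → x ≢ b → x ≢ c → cyc3 a b c x ≡ x
cyc3-fixes {a} {b} {c} {x} x≢a x≢b x≢c with x ≟ a | x ≟ b | x ≟ c
... | yes x≡a | _ | _ = ⊥-elim (x≢a x≡a)
... | no _ | yes x≡b | _ = ⊥-elim (x≢b x≡b)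
... | no _ | no _ | yes x≡c = ⊥-elim (x≢c x≡c)
... | no _ | no _ | no _ = refl

cyc3-splits : ∀ {a b c} → a ≢ b → b ≢ c → a ≢ c → ∀ x →
  (cyc3 a b c x ≡ swapℕ b c (swapℕ a c x)) × (cyc3 a b c x ≡ swapℕ b a (swapℕ b c x)) ×
  (cyc3 a b c x ≡ swapℕ c a (swapℕ a b x))
cyc3-splits {a} {b} {c} a≢b b≢c a≢c x with a ≟ x | b ≟ x | c ≟ x
... | yes refl | _ | _ =
    trans (cyc3-first x b c) (sym (trans (cong (swapℕ b c) (swapℕ-left x c)) (swapℕ-right b c)))
  , trans (cyc3-first x b c) (sym (trans (cong (swapℕ b x) (swapℕ-fixes a≢b a≢c)) (swapℕ-right b x)))
  , trans (cyc3-first x b c) (sym (trans (cong (swapℕ c x) (swapℕ-left x b)) (swapℕ-fixes b≢c (a≢b ∘′ sym))))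
... | no a≢x | yes refl | _ =
    trans (cyc3-second x≢a) (sym (trans (cong (swapℕ x c) (swapℕ-fixes x≢a b≢c)) (swapℕ-left x c)))
  , trans (cyc3-second x≢a) (sym (trans (cong (swapℕ x a) (swapℕ-left x c)) (swapℕ-fixes (b≢c ∘′ sym) (a≢c ∘′ sym))))
  , trans (cyc3-second x≢a) (sym (trans (cong (swapℕ c a) (swapℕ-right a x)) (swapℕ-right c a)))
  where
  x≢a : x ≢ a
  x≢a = a≢x ∘′ sym
... | no a≢x | no b≢x | yes refl =
    trans (cyc3-third x≢a x≢b) (sym (trans (cong (swapℕ b x) (swapℕ-right a x)) (swapℕ-fixes a≢b a≢c)))
  , trans (cyc3-third x≢a x≢b) (sym (trans (cong (swapℕ b a) (swapℕ-right b x)) (swapℕ-left b a)))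
  , trans (cyc3-third x≢a x≢b) (sym (trans (cong (swapℕ x a) (swapℕ-fixes x≢a x≢b)) (swapℕ-left x a)))
  where
  x≢a : x ≢ a
  x≢a = a≢x ∘′ sym
  x≢b : x ≢ b
  x≢b = b≢x ∘′ sym
... | no a≢x | no b≢x | no c≢x =
    trans fixed (sym (trans (cong (swapℕ b c) (swapℕ-fixes x≢a x≢c)) (swapℕ-fixes x≢b x≢c)))
  , trans fixed (sym (trans (cong (swapℕ b a) (swapℕ-fixes x≢b x≢c)) (swapℕ-fixes x≢b x≢a)))
  , trans fixed (sym (trans (cong (swapℕ c a) (swapℕ-fixes x≢a x≢b)) (swapℕ-fixes x≢c x≢a)))
  where
  x≢a : x ≢ a
  x≢a = a≢x ∘′ sym
  x≢b : x ≢ b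
  x≢b = b≢x ∘′ sym
  x≢c : x ≢ c
  x≢c = c≢x ∘′ sym
  fixed : cyc3 a b c x ≡ x
  fixed = cyc3-fixes x≢a x≢b x≢c

Unique-⊆-length≤ : ∀ {A : Set} {xs ys : List A} → Unique xs → xs ⊆ ys → length xs ≤ length ys
Unique-⊆-length≤ [] _ = z≤n
Unique-⊆-length≤ {xs = x ∷ xs} (x∉ ∷ u) xs⊆ys with ∈-∃++ (xs⊆ys (here refl))
... | ys₁ , ys₂ , refl =
  subst (suc (length xs) ≤_) (sym (length-++-sucʳ ys₁ x ys₂)) (s≤s (Unique-⊆-length≤ u xs⊆ys₁++ys₂))
  where
  xs⊆ys₁++ys₂ : xs ⊆ ys₁ ++ ys₂
  xs⊆ys₁++ys₂ {z} z∈ with ∈-++⁻ ys₁ (xs⊆ys (there z∈))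
  ... | inj₁ z∈₁ = ∈-++⁺ˡ z∈₁
  ... | inj₂ (here z≡x) = ⊥-elim (All.lookup x∉ z∈ (sym z≡x))
  ... | inj₂ (there z∈₂) = ∈-++⁺ʳ ys₁ z∈₂

InRange : ℕ → ℕ → Set
InRange m x = 1 ≤ x × x ≤ m

∈-range1 : ∀ {m x} → InRange m x → x ∈ range1 m
∈-range1 {x = suc x} (_ , x≤m) = ∈-map⁺ suc (∈-upTo⁺ x≤m)

range1⁻ : ∀ {m j} → j ∈ range1 m → InRange m j
range1⁻ j∈ with ∈-map⁻ suc j∈
... | i , i∈ , refl = s≤s z≤n , ∈-upTo⁻ i∈

length-range1 : ∀ m → length (range1 m) ≡ m
length-range1 m = trans (length-map suc (upTo m)) (length-upTo m)

Unique-full : ∀ {m x} {xs : List ℕ} → Unique xs → All (InRange m) xs → length xs ≡ m → InRange m x → x ∈ xs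
Unique-full {m} {x} {xs} u all len x∈m with x ∈? xs
... | yes x∈ = x∈
... | no x∉ = ⊥-elim (<-irrefl refl (begin-strict
      m                    ≡⟨ sym len ⟩
      length xs            <⟨ Unique-⊆-length≤ (¬Any⇒All¬ xs x∉ ∷ u) sub ⟩
      length (range1 m)    ≡⟨ length-range1 m ⟩
      m                    ∎))
  where
  open ≤-Reasoning
  sub : x ∷ xs ⊆ range1 m
  sub (here refl) = ∈-range1 x∈m
  sub (there y∈) = ∈-range1 (All.lookup all y∈)

+-double : ∀ a m → a + 2 * m ≡ a + m + m
+-double = solve-∀

+-double-both : ∀ a m → a + (a + 2 * m) ≡ (a + m) + (a + m)
+-double-both = solve-∀

*-double-around : ∀ a m → a + 2 * m + a ≡ 2 * (a + m)
*-double-around = solve-∀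

arcs-total : ∀ h u v → h + 2 * u + 2 * v + h ≡ 2 * (h + u + v)
arcs-total = solve-∀

parity : ∀ d → ∃[ t ] (d ≡ 2 * t ⊎ d ≡ suc (2 * t))
parity zero = 0 , inj₁ refl
parity (suc d) with parity d
... | t , inj₁ refl = t , inj₂ refl
... | t , inj₂ refl = suc t , inj₁ (sym (*-suc 2 t))

half-double : ∀ m → 2 * m / 2 ≡ m
half-double m = trans (cong (_/ 2) (*-comm 2 m)) (m*n/n≡m m 2)

suc-parity : ∀ x → suc x % 2 ≢ x % 2
suc-parity zero ()
suc-parity (suc x) eq = suc-parity x (sym (trans (sym [x+2]%2≡x%2) eq))
  where
  [x+2]%2≡x%2 : suc (suc x) % 2 ≡ x % 2
  [x+2]%2≡x%2 = trans (cong (_% 2) (+-comm 2 x)) ([m+n]%n≡m%n x 2)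

double-injective : ∀ {x y} → x + x ≡ y + y → x ≡ y
double-injective {x} {y} x+x≡y+y with <-cmp x y
... | tri< x<y _ _ = ⊥-elim (<⇒≢ (+-mono-< x<y x<y) x+x≡y+y)
... | tri≈ _ x≡y _ = x≡y
... | tri> _ _ y<x = ⊥-elim (>⇒≢ (+-mono-< y<x y<x) x+x≡y+y)

partner-is-predecessor : ∀ {a y m} → a + suc y ≡ suc (m + m) → a ≡ y ⇔ y ≡ m
partner-is-predecessor {a} {y} {m} sum = mk⇔
  (λ a≡y → double-injective (suc-injective (trans (sym (+-suc y y)) (trans (cong (_+ suc y) (sym a≡y)) sum))))
  (λ y≡m → +-cancelʳ-≡ (suc y) a y (trans sum (sym (trans (+-suc y y) (cong (λ x → suc (x + x)) y≡m)))))

reflect-above : ∀ {a c y z} → z + y ≡ a + c → y < c → a < z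
reflect-above {a} {c} {y} {z} z+y≡a+c y<c =
  +-cancelʳ-< y a z (begin-strict a + y <⟨ +-monoʳ-< a y<c ⟩ a + c ≡⟨ sym z+y≡a+c ⟩ z + y ∎)
  where open ≤-Reasoning

reflect-below : ∀ {a c y z} → z + y ≡ a + c → a < y → z < c
reflect-below {a} {c} {y} {z} z+y≡a+c a<y =
  +-cancelʳ-< y z c (begin-strict z + y ≡⟨ z+y≡a+c ⟩ a + c <⟨ +-monoˡ-< c a<y ⟩ y + c ≡⟨ +-comm y c ⟩ c + y ∎)
  where open ≤-Reasoning

same-partner : ∀ {a b y S} → a + y ≡ S → b + suc y ≡ suc S → a ≡ b
same-partner {a} {b} {y} a+y≡S b+1+y≡1+S = +-cancelʳ-≡ (suc y) a b (trans (+-suc a y) (trans (cong suc a+y≡S) (sym b+1+y≡1+S)))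

-- Blocks of nested transpositions

∈-entries-map⁻ : ∀ {f g : ℕ → ℕ} {y} xs → y ∈ entries (map (λ j → f j , g j) xs) →
  ∃[ j ] (j ∈ xs × (y ≡ f j ⊎ y ≡ g j))
∈-entries-map⁻ xs y∈ with ∈-entries⁻ (map _ xs) y∈
... | _ , inj₁ p∈ with ∈-map⁻ _ p∈
...   | j , j∈ , refl = j , j∈ , inj₁ refl
∈-entries-map⁻ xs y∈ | _ , inj₂ p∈ with ∈-map⁻ _ p∈
...   | j , j∈ , refl = j , j∈ , inj₂ refl

Unique-entries-map : ∀ {f g : ℕ → ℕ} {xs} → Unique xs →
  (∀ {i j} → i ∈ xs → j ∈ xs → f i ≡ f j → i ≡ j) →
  (∀ {i j} → i ∈ xs → j ∈ xs → g i ≡ g j → i ≡ j) →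
  (∀ {i j} → i ∈ xs → j ∈ xs → f i ≢ g j) →
  Unique (entries (map (λ j → f j , g j) xs))
Unique-entries-map {xs = []} _ _ _ _ = []
Unique-entries-map {f} {g} {x ∷ xs} (x∉ ∷ u) f-inj g-inj f≢g =
  (f≢g (here refl) (here refl) ∷ All.tabulate fx≢) ∷ All.tabulate gx≢ ∷
  Unique-entries-map u (λ i∈ j∈ → f-inj (there i∈) (there j∈)) (λ i∈ j∈ → g-inj (there i∈) (there j∈))
    (λ i∈ j∈ → f≢g (there i∈) (there j∈))
  where
  x≢ : ∀ {j} → j ∈ xs → x ≢ j
  x≢ j∈ x≡j = All¬⇒¬Any x∉ (subst (_∈ xs) (sym x≡j) j∈)
  fx≢ : ∀ {y} → y ∈ entries (map (λ j → f j , g j) xs) → f x ≢ y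
  fx≢ y∈ with ∈-entries-map⁻ xs y∈
  ... | j , j∈ , inj₁ refl = x≢ j∈ ∘′ f-inj (here refl) (there j∈)
  ... | j , j∈ , inj₂ refl = f≢g (here refl) (there j∈)
  gx≢ : ∀ {y} → y ∈ entries (map (λ j → f j , g j) xs) → g x ≢ y
  gx≢ y∈ with ∈-entries-map⁻ xs y∈
  ... | j , j∈ , inj₁ refl = f≢g (there j∈) (here refl) ∘′ sym
  ... | j , j∈ , inj₂ refl = x≢ j∈ ∘′ g-inj (here refl) (there j∈)

-- ∏_{j = 1}^{m} (a + j, c − j): every product in the proposition has this shape
Block : ℕ → ℕ → ℕ → List (ℕ × ℕ)
Block a c m = map (λ j → a + j , c ∸ j) (range1 m)

length-Block : ∀ a c m → length (Block a c m) ≡ m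
length-Block a c m = trans (length-map _ (range1 m)) (length-range1 m)

Block-snoc : ∀ a c m → Block a c (suc m) ≡ Block a c m ++ (a + suc m , c ∸ suc m) ∷ []
Block-snoc a c m = begin
    map F (map suc (upTo (suc m)))          ≡⟨ cong (map F ∘′ map suc) (sym (upTo-∷ʳ m)) ⟩
    map F (map suc (upTo m ++ m ∷ []))      ≡⟨ cong (map F) (map-++ suc (upTo m) (m ∷ [])) ⟩
    map F (range1 m ++ suc m ∷ [])          ≡⟨ map-++ F (range1 m) (suc m ∷ []) ⟩
    Block a c m ++ (a + suc m , c ∸ suc m) ∷ [] ∎
  where
  open ≡-Reasoning
  F : ℕ → ℕ × ℕ
  F j = a + j , c ∸ j

InBlock : ℕ → ℕ → ℕ → ℕ → Set
InBlock a c m y = (a < y × y ≤ a + m) ⊎ (c ≤ y + m × y < c)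

Block-unique : ∀ a c m → a + 2 * m < c → Unique (entries (Block a c m))
Block-unique a c m a+2m<c =
  Unique-entries-map (Unique.map⁺ suc-injective (Unique.upTo⁺ m))
    (λ _ _ → +-cancelˡ-≡ a _ _) (λ i∈ j∈ → ∸-cancelˡ-≡ (≤c i∈) (≤c j∈)) f≢g
  where
  m≤c : m ≤ c
  m≤c = ≤-trans (≤-trans (m≤m+n m (m + 0)) (m≤n+m (2 * m) a)) (<⇒≤ a+2m<c)
  ≤c : ∀ {j} → j ∈ range1 m → j ≤ c
  ≤c j∈ = ≤-trans (proj₂ (range1⁻ j∈)) m≤c
  f≢g : ∀ {i j} → i ∈ range1 m → j ∈ range1 m → a + i ≢ c ∸ j
  f≢g {i} {j} i∈ j∈ a+i≡c∸j = <-irrefl refl (begin-strict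
    c             ≡⟨ sym (m∸n+n≡m (≤c j∈)) ⟩
    c ∸ j + j     ≡⟨ cong (_+ j) (sym a+i≡c∸j) ⟩
    a + i + j     ≤⟨ +-mono-≤ (+-monoʳ-≤ a (proj₂ (range1⁻ i∈))) (proj₂ (range1⁻ j∈)) ⟩
    a + m + m     ≡⟨ sym (+-double a m) ⟩
    a + 2 * m     <⟨ a+2m<c ⟩
    c             ∎)
    where open ≤-Reasoning

∈-Block⇒InBlock : ∀ {a c m x} → m ≤ c → x ∈ entries (Block a c m) → InBlock a c m x
∈-Block⇒InBlock {a} {c} {m} m≤c x∈ with ∈-entries-map⁻ (range1 m) x∈
... | j , j∈ , inj₁ refl = inj₁ (m<m+n a (proj₁ (range1⁻ j∈)) , +-monoʳ-≤ a (proj₂ (range1⁻ j∈)))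
... | j , j∈ , inj₂ refl =
  inj₂ ( ≤-trans (≤-reflexive (sym (m∸n+n≡m j≤c))) (+-monoʳ-≤ (c ∸ j) (proj₂ (range1⁻ j∈)))
       , ∸-monoʳ-< (proj₁ (range1⁻ j∈)) j≤c )
  where
  j≤c : j ≤ c
  j≤c = ≤-trans (proj₂ (range1⁻ j∈)) m≤c

InBlock⇒between : ∀ {a c m x} → a + m < c → InBlock a c m x → a < x × x < c
InBlock⇒between a+m<c (inj₁ (a<x , x≤a+m)) = a<x , ≤-<-trans x≤a+m a+m<c
InBlock⇒between {a} {c} {m} {x} a+m<c (inj₂ (c≤x+m , x<c)) = +-cancelʳ-< m a x (<-≤-trans a+m<c c≤x+m) , x<c

∈-Block⇒between : ∀ {a c m x} → a + m < c → x ∈ entries (Block a c m) → a < x × x < c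
∈-Block⇒between {a} {c} {m} a+m<c x∈ =
  InBlock⇒between a+m<c (∈-Block⇒InBlock (≤-trans (m≤n+m m a) (<⇒≤ a+m<c)) x∈)

gapped-hull : ∀ {a c m} → c ≡ a + suc m + suc m → a + m < c
gapped-hull {a} {c} {m} c≡ =
  subst (a + m <_) (sym c≡) (<-≤-trans (+-monoʳ-< a (n<1+n m)) (m≤m+n (a + suc m) (suc m)))

gapped-hull′ : ∀ {a c m} → c ≡ a + suc m + suc m → m ≤ c
gapped-hull′ {a} c≡ = ≤-trans (m≤n+m _ a) (<⇒≤ (gapped-hull c≡))

∈-gapped-Block : ∀ {a c m x} → c ≡ a + suc m + suc m → x ∈ entries (Block a c m) →
  a < x × x < c × x ≢ a + suc m
∈-gapped-Block {a} {c} {m} {x} c≡ x∈ =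
  proj₁ hull , proj₂ hull , avoids-gap x∈Block
  where
  x∈Block : InBlock a c m x
  x∈Block = ∈-Block⇒InBlock (gapped-hull′ c≡) x∈
  hull : a < x × x < c
  hull = InBlock⇒between (gapped-hull c≡) x∈Block
  avoids-gap : InBlock a c m x → x ≢ a + suc m
  avoids-gap (inj₁ (_ , x≤a+m)) refl = <⇒≱ (+-monoʳ-< a (n<1+n m)) x≤a+m
  avoids-gap (inj₂ (c≤x+m , _)) refl = <-irrefl refl (begin-strict
      c                   ≤⟨ c≤x+m ⟩
      a + suc m + m       <⟨ +-monoʳ-< (a + suc m) (n<1+n m) ⟩
      a + suc m + suc m   ≡⟨ sym c≡ ⟩
      c                   ∎)
    where open ≤-Reasoning

Block-reflect : ∀ {a c m y} ps → Unique (entries ps) → Block a c m ⊆ ps → m ≤ c →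
  InBlock a c m y → prodT ps y + y ≡ a + c
Block-reflect {a} {c} {m} {y} ps u B⊆ps m≤c (inj₁ (a<y , y≤a+m)) = begin
    prodT ps y + y             ≡⟨ cong (λ z → prodT ps z + z) (sym a+j≡y) ⟩
    prodT ps (a + j) + (a + j) ≡⟨ cong (_+ (a + j)) (prodT-partner ps u (inj₁ (B⊆ps (∈-map⁺ _ (∈-range1 j∈m))))) ⟩
    c ∸ j + (a + j)            ≡⟨ +-comm (c ∸ j) (a + j) ⟩
    a + j + (c ∸ j)            ≡⟨ +-assoc a j (c ∸ j) ⟩
    a + (j + (c ∸ j))          ≡⟨ cong (a +_) (m+[n∸m]≡n (≤-trans (proj₂ j∈m) m≤c)) ⟩
    a + c                      ∎
  where
  open ≡-Reasoning
  j = y ∸ a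
  a+j≡y : a + j ≡ y
  a+j≡y = m+[n∸m]≡n (<⇒≤ a<y)
  j∈m : InRange m j
  j∈m = m<n⇒0<n∸m a<y , m≤n+o⇒m∸n≤o y a y≤a+m
Block-reflect {a} {c} {m} {y} ps u B⊆ps m≤c (inj₂ (c≤y+m , y<c)) = begin
    prodT ps y + y             ≡⟨ cong (λ z → prodT ps z + z) (sym c∸j≡y) ⟩
    prodT ps (c ∸ j) + (c ∸ j) ≡⟨ cong (_+ (c ∸ j)) (prodT-partner ps u (inj₂ (B⊆ps (∈-map⁺ _ (∈-range1 j∈m))))) ⟩
    a + j + (c ∸ j)            ≡⟨ +-assoc a j (c ∸ j) ⟩
    a + (j + (c ∸ j))          ≡⟨ cong (a +_) (m+[n∸m]≡n (≤-trans (proj₂ j∈m) m≤c)) ⟩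
    a + c                      ∎
  where
  open ≡-Reasoning
  j = c ∸ y
  c∸j≡y : c ∸ j ≡ y
  c∸j≡y = m∸[m∸n]≡n (<⇒≤ y<c)
  j∈m : InRange m j
  j∈m = m<n⇒0<n∸m y<c , m≤n+o⇒m∸n≤o c y c≤y+m

Block-arc-reflect : ∀ {a b m y} ps → Unique (entries ps) → Block a (suc b) m ⊆ ps → b ≡ a + m + m →
  a < y → y ≤ b → prodT ps y + y ≡ suc (a + b)
Block-arc-reflect {a} {b} {m} {y} ps u B⊆ps b≡ a<y y≤b =
  trans (Block-reflect ps u B⊆ps m≤1+b y∈) (+-suc a b)
  where
  m≤1+b : m ≤ suc b
  m≤1+b = ≤-trans (m≤n+m m (a + m)) (≤-trans (≤-reflexive (sym b≡)) (n≤1+n b))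
  y∈ : InBlock a (suc b) m y
  y∈ with y ≤? a + m
  ... | yes y≤a+m = inj₁ (a<y , y≤a+m)
  ... | no y≰a+m = inj₂ (subst (_≤ y + m) (cong suc (sym b≡)) (+-monoˡ-≤ m (≰⇒> y≰a+m)) , s≤s y≤b)

-- the gap point a + m + 1 is fixed, and it is its own mirror image
Block-gap-reflect : ∀ {a c m y} ps → Unique (entries ps) → Block a c m ⊆ ps → c ≡ a + suc m + suc m →
  a + suc m ∉ entries ps → a < y → y < c → prodT ps y + y ≡ a + c
Block-gap-reflect {a} {c} {m} {y} ps u B⊆ps c≡ gap∉ a<y y<c with <-cmp y (a + suc m)
... | tri< y<gap _ _ = Block-reflect ps u B⊆ps (gapped-hull′ c≡) (inj₁ (a<y , ≤-pred (subst (y <_) (+-suc a m) y<gap)))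
... | tri≈ _ refl _ = begin
    prodT ps (a + suc m) + (a + suc m) ≡⟨ cong (_+ (a + suc m)) (prodT-fixes ps gap∉) ⟩
    a + suc m + (a + suc m)           ≡⟨ twice-gap a m ⟩
    a + (a + suc m + suc m)           ≡⟨ cong (a +_) (sym c≡) ⟩
    a + c                             ∎
  where
  open ≡-Reasoning
  twice-gap : ∀ a m → a + suc m + (a + suc m) ≡ a + (a + suc m + suc m)
  twice-gap = solve-∀
... | tri> _ _ gap<y = Block-reflect ps u B⊆ps (gapped-hull′ c≡) (inj₂ (c≤y+m , y<c))
  where
  c≤y+m : c ≤ y + m
  c≤y+m = begin
    c                     ≡⟨ c≡ ⟩
    a + suc m + suc m     ≡⟨ +-suc (a + suc m) m ⟩
    suc (a + suc m) + m   ≤⟨ +-monoˡ-≤ m gap<y ⟩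
    y + m                 ∎
    where open ≤-Reasoning

-- An involution followed by a transposition

record ThreeCycle (r : ℕ → ℕ) (a : ℕ) : Set where
  field
    a≢ra   : a ≢ r a
    ra≢rra : r a ≢ r (r a)
    a≢rra  : a ≢ r (r a)
    r³a≡a  : r (r (r a)) ≡ a

OnCycle : (ℕ → ℕ) → ℕ → ℕ → Set
OnCycle r a w = w ≡ a ⊎ w ≡ r a ⊎ w ≡ r (r a)

module _ {r : ℕ → ℕ} {a : ℕ} (C : ThreeCycle r a) where
  open ThreeCycle C

  ThreeCycle-next : ThreeCycle r (r a)
  ThreeCycle-next = record
    { a≢ra = ra≢rra ; ra≢rra = λ eq → a≢rra (trans (sym r³a≡a) (sym eq)) ; a≢rra = λ eq → a≢ra (sym (trans eq r³a≡a))
    ; r³a≡a = cong r r³a≡a }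

  OnCycle-next : ∀ {w} → OnCycle r a w → OnCycle r (r a) w
  OnCycle-next (inj₁ refl) = inj₂ (inj₂ (sym r³a≡a))
  OnCycle-next (inj₂ (inj₁ refl)) = inj₁ refl
  OnCycle-next (inj₂ (inj₂ refl)) = inj₂ (inj₁ refl)

  OnCycle-prev : ∀ {w} → OnCycle r (r a) w → OnCycle r a w
  OnCycle-prev (inj₁ refl) = inj₂ (inj₁ refl)
  OnCycle-prev (inj₂ (inj₁ refl)) = inj₂ (inj₂ refl)
  OnCycle-prev (inj₂ (inj₂ refl)) = inj₁ r³a≡a

rotate-cycle : ∀ {r a w} → ThreeCycle r a → OnCycle r a w →
  ThreeCycle r w × (∀ {x} → OnCycle r w x → OnCycle r a x) × (∀ {x} → OnCycle r a x → OnCycle r w x)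
rotate-cycle C (inj₁ refl) = C , (λ on → on) , (λ on → on)
rotate-cycle C (inj₂ (inj₁ refl)) = ThreeCycle-next C , OnCycle-prev C , OnCycle-next C
rotate-cycle C (inj₂ (inj₂ refl)) =
  ThreeCycle-next (ThreeCycle-next C) , OnCycle-prev C ∘′ OnCycle-prev (ThreeCycle-next C) ,
  OnCycle-next (ThreeCycle-next C) ∘′ OnCycle-next C

cycle-max-on : ∀ r a → OnCycle r a (a ⊔ (r a ⊔ r (r a)))
cycle-max-on r a with ⊔-sel a (r a ⊔ r (r a))
... | inj₁ top≡a = inj₁ top≡a
... | inj₂ top≡ with ⊔-sel (r a) (r (r a))
...   | inj₁ ≡ra = inj₂ (inj₁ (trans top≡ ≡ra))
...   | inj₂ ≡rra = inj₂ (inj₂ (trans top≡ ≡rra))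

cycle-max-bound : ∀ r a {w} → OnCycle r a w → w ≤ a ⊔ (r a ⊔ r (r a))
cycle-max-bound r a (inj₁ refl) = m≤m⊔n a _
cycle-max-bound r a (inj₂ (inj₁ refl)) = ≤-trans (m≤m⊔n (r a) _) (m≤n⊔m a _)
cycle-max-bound r a (inj₂ (inj₂ refl)) = ≤-trans (m≤n⊔m (r a) _) (m≤n⊔m a _)

involution-injective : ∀ {f : ℕ → ℕ} → (∀ y → f (f y) ≡ y) → ∀ {x y} → f x ≡ f y → x ≡ y
involution-injective {f} f-inv {x} {y} eq = trans (sym (f-inv x)) (trans (cong f eq) (f-inv y))

module _ (s₁ : ℕ → ℕ) (s₁-involutive : ∀ y → s₁ (s₁ y) ≡ y) (p q : ℕ) where
  private
    r : ℕ → ℕ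
    r y = swapℕ p q (s₁ y)

    r-injective : ∀ {x y} → r x ≡ r y → x ≡ y
    r-injective = involution-injective {s₁} s₁-involutive ∘′ involution-injective {swapℕ p q} (swapℕ-involutive p q)

    moved : ∀ {x} → r (r x) ≢ x → x ∈ p ∷ q ∷ s₁ p ∷ s₁ q ∷ []
    moved {x} r²x≢x with x ∈? p ∷ q ∷ s₁ p ∷ s₁ q ∷ []
    ... | yes x∈ = x∈
    ... | no x∉ = ⊥-elim (r²x≢x (begin
        swapℕ p q (s₁ (swapℕ p q (s₁ x))) ≡⟨ cong (swapℕ p q ∘′ s₁) (swapℕ-fixes s₁x≢p s₁x≢q) ⟩
        swapℕ p q (s₁ (s₁ x))             ≡⟨ cong (swapℕ p q) (s₁-involutive x) ⟩
        swapℕ p q x                       ≡⟨ swapℕ-fixes (x∉ ∘′ here) (x∉ ∘′ there ∘′ here) ⟩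
        x                                 ∎))
      where
      open ≡-Reasoning
      s₁x≢p : s₁ x ≢ p
      s₁x≢p eq = x∉ (there (there (here (trans (sym (s₁-involutive x)) (cong s₁ eq)))))
      s₁x≢q : s₁ x ≢ q
      s₁x≢q eq = x∉ (there (there (there (here (trans (sym (s₁-involutive x)) (cong s₁ eq))))))

  -- Two disjoint r-orbits of size three would need six points moved by r², but at most four are.
  off-cycle-involutive : ∀ {a} → ThreeCycle r a → ∀ {w} → ¬ OnCycle r a w → r (r w) ≡ w
  off-cycle-involutive {a} C {w} w∉ with r (r w) ≟ w
  ... | yes r²w≡w = r²w≡w
  ... | no r²w≢w = ⊥-elim (6≰4 (Unique-⊆-length≤ orbits-unique (moved ∘′ All.lookup orbits-moved)))
    where
    open ThreeCycle C
    6≰4 : ¬ (6 ≤ 4)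
    6≰4 (s≤s (s≤s (s≤s (s≤s ()))))
    off-closed : ∀ {x} → ¬ OnCycle r a x → ¬ OnCycle r a (r x)
    off-closed x∉ (inj₁ rx≡a) = x∉ (inj₂ (inj₂ (r-injective (trans rx≡a (sym r³a≡a)))))
    off-closed x∉ (inj₂ (inj₁ rx≡ra)) = x∉ (inj₁ (r-injective rx≡ra))
    off-closed x∉ (inj₂ (inj₂ rx≡rra)) = x∉ (inj₂ (inj₁ (r-injective rx≡rra)))
    w≢rw : w ≢ r w
    w≢rw w≡rw = r²w≢w (trans (cong r (sym w≡rw)) (sym w≡rw))
    rw∉ = off-closed w∉
    rrw∉ = off-closed rw∉
    apart : ∀ {x} → ¬ OnCycle r a x → All (_≢ x) (a ∷ r a ∷ r (r a) ∷ [])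
    apart x∉ = (x∉ ∘′ inj₁ ∘′ sym) ∷ (x∉ ∘′ inj₂ ∘′ inj₁ ∘′ sym) ∷ (x∉ ∘′ inj₂ ∘′ inj₂ ∘′ sym) ∷ []
    orbits-unique : Unique (a ∷ r a ∷ r (r a) ∷ w ∷ r w ∷ r (r w) ∷ [])
    orbits-unique =
      (a≢ra ∷ a≢rra ∷ All.head (apart w∉) ∷ All.head (apart rw∉) ∷ All.head (apart rrw∉) ∷ []) ∷
      (ra≢rra ∷ All.head (All.tail (apart w∉)) ∷ All.head (All.tail (apart rw∉)) ∷ All.head (All.tail (apart rrw∉)) ∷ []) ∷
      (All.lookup (apart w∉) (there (there (here refl))) ∷ All.lookup (apart rw∉) (there (there (here refl))) ∷
       All.lookup (apart rrw∉) (there (there (here refl))) ∷ []) ∷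
      (w≢rw ∷ (r²w≢w ∘′ sym) ∷ []) ∷
      ((w≢rw ∘′ r-injective) ∷ []) ∷ [] ∷ []
    orbits-moved : All (λ x → r (r x) ≢ x) (a ∷ r a ∷ r (r a) ∷ w ∷ r w ∷ r (r w) ∷ [])
    orbits-moved =
      (a≢rra ∘′ sym) ∷ (a≢ra ∘′ trans (sym r³a≡a)) ∷ (ra≢rra ∘′ trans (sym (cong r r³a≡a))) ∷ r²w≢w ∷
      (r²w≢w ∘′ r-injective) ∷ (r²w≢w ∘′ r-injective ∘′ r-injective) ∷ []

-- Involutions shifted by the long cycle

-- the form of σ₀ in the proposition, with e = 2n − h
record Chords (N h k e : ℕ) (f : ℕ → ℕ) : Set where
  field
    outerˡ : ∀ {y} → 1 ≤ y → y ≤ h → f y + y ≡ suc N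
    outerʳ : ∀ {y} → e < y → y ≤ N → f y + y ≡ suc N
    middle : ∀ {y} → h < y → y ≤ k → f y + y ≡ suc (h + k)
    inner  : ∀ {y} → k < y → y ≤ e → f y + y ≡ suc (k + e)

Chords-unique : ∀ {N h k e f g} → Chords N h k e f → Chords N h k e g → ∀ {y} → InRange N y → f y ≡ g y
Chords-unique {N} {h} {k} {e} {f} {g} F G {y} (1≤y , y≤N) = +-cancelʳ-≡ y (f y) (g y) same-sum
  where
  module F = Chords F
  module G = Chords G
  same-sum : f y + y ≡ g y + y
  same-sum with y ≤? h
  ... | yes y≤h = trans (F.outerˡ 1≤y y≤h) (sym (G.outerˡ 1≤y y≤h))
  ... | no y≰h with y ≤? k
  ...   | yes y≤k = trans (F.middle (≰⇒> y≰h) y≤k) (sym (G.middle (≰⇒> y≰h) y≤k))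
  ...   | no y≰k with y ≤? e
  ...     | yes y≤e = trans (F.inner (≰⇒> y≰k) y≤e) (sym (G.inner (≰⇒> y≰k) y≤e))
  ...     | no y≰e = trans (F.outerʳ (≰⇒> y≰e) y≤N) (sym (G.outerʳ (≰⇒> y≰e) y≤N))

-- s and r are σ₀ and σ₁τ on labels; r-shift is the relation σ₀σ∞σ₁τ = id
module ShiftedInvolution
  {N : ℕ} {s r : ℕ → ℕ}
  (s-involutive : ∀ y → s (s y) ≡ y)
  (s-range : ∀ {y} → InRange N y → InRange N (s y))
  (s-fixedPointFree : ∀ {y} → InRange N y → s y ≢ y)
  (r-shift : ∀ {w} → 1 ≤ w → w < N → r w ≡ s (suc w))
  (s1≡N : s 1 ≡ N)
  (rN≡N : r N ≡ N)
  {e : ℕ} (cycle : ThreeCycle r e) (e-range : InRange N e)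
  (e-max : ∀ {w} → OnCycle r e w → w ≤ e)
  (r²-off : ∀ {w} → ¬ OnCycle r e w → r (r w) ≡ w)
  where

  open ThreeCycle cycle

  Free : ℕ → Set
  Free i = 1 ≤ i × i < N × ¬ OnCycle r e i

  propagate : ∀ {w z} → Free w → s (suc w) ≡ z → z < N → s (suc z) ≡ w
  propagate {w} {z} (1≤w , w<N , w∉) sw≡z z<N = begin
      s (suc z) ≡⟨ sym (r-shift 1≤z z<N) ⟩
      r z       ≡⟨ cong r (sym (trans (r-shift 1≤w w<N) sw≡z)) ⟩
      r (r w)   ≡⟨ r²-off w∉ ⟩
      w         ∎
    where
    open ≡-Reasoning
    1≤z : 1 ≤ z
    1≤z = subst (1 ≤_) sw≡z (proj₁ (s-range (s≤s z≤n , w<N)))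

  run : ∀ t {x z} → s (x + t) ≡ z → z + t ≤ N → (∀ {i} → x ≤ i → i < x + t → Free i) → s x ≡ z + t
  run zero {x} {z} eq _ _ = subst₂ (λ a b → s a ≡ b) (+-identityʳ x) (sym (+-identityʳ z)) eq
  run (suc t) {x} {z} eq bound free =
    trans (run t s[x+t]≡1+z (subst (_≤ N) (+-suc z t) bound) (λ x≤i i<x+t → free x≤i (<-trans i<x+t x+t<x+1+t)))
          (sym (+-suc z t))
    where
    x+t<x+1+t : x + t < x + suc t
    x+t<x+1+t = +-monoʳ-< x (n<1+n t)
    z<N : z < N
    z<N = <-≤-trans (m<m+n z z<s) bound
    s[x+t]≡1+z : s (x + t) ≡ suc z
    s[x+t]≡1+z = trans (cong s (sym (propagate (free (m≤m+n x t) x+t<x+1+t) (trans (cong s (sym (+-suc x t))) eq) z<N)))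
                       (s-involutive (suc z))

  arc : ∀ {lo top bot} → s top ≡ bot → bot ≤ lo → top ≤ N → (∀ {i} → lo ≤ i → i < top → Free i) →
        ∀ {y} → lo ≤ y → y ≤ top → s y + y ≡ top + bot
  arc {lo} {top} {bot} s-top bot≤lo top≤N free {y} lo≤y y≤top = begin
      s y + y         ≡⟨ cong (_+ y) sy≡bot+t ⟩
      bot + t + y     ≡⟨ +-assoc bot t y ⟩
      bot + (t + y)   ≡⟨ cong (bot +_) (trans (+-comm t y) y+t≡top) ⟩
      bot + top       ≡⟨ +-comm bot top ⟩
      top + bot       ∎
    where
    open ≡-Reasoning
    t = top ∸ y
    y+t≡top : y + t ≡ top
    y+t≡top = m+[n∸m]≡n y≤top
    sy≡bot+t : s y ≡ bot + t
    sy≡bot+t = run t (subst (λ a → s a ≡ bot) (sym y+t≡top) s-top)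
      (≤-trans (+-monoˡ-≤ t (≤-trans bot≤lo lo≤y)) (subst (_≤ N) (sym y+t≡top) top≤N))
      (λ y≤i i<y+t → free (≤-trans lo≤y y≤i) (subst (_ <_) y+t≡top i<y+t))

  e<N : e < N
  e<N = ≤∧≢⇒< (proj₂ e-range) (λ e≡N → a≢ra (trans e≡N (sym (trans (cong r e≡N) rN≡N))))

  h : ℕ
  h = N ∸ e

  e+h≡N : e + h ≡ N
  e+h≡N = m+[n∸m]≡n (<⇒≤ e<N)

  1≤h : 1 ≤ h
  1≤h = m<n⇒0<n∸m e<N

  h<N : h < N
  h<N = subst (h <_) (trans (+-comm h e) e+h≡N) (m<m+n h (proj₁ e-range))

  1+h+e≡1+N : suc h + e ≡ suc N
  1+h+e≡1+N = cong suc (trans (+-comm h e) e+h≡N)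

  free-above : ∀ {i} → suc e ≤ i → i < N → Free i
  free-above e<i i<N = ≤-trans (s≤s z≤n) e<i , i<N , λ on → <⇒≱ e<i (e-max on)

  outerʳ : ∀ {y} → e < y → y ≤ N → s y + y ≡ suc N
  outerʳ e<y y≤N =
    trans (arc (trans (cong s (sym s1≡N)) (s-involutive 1)) (s≤s z≤n) ≤-refl free-above e<y y≤N) (+-comm N 1)

  outerˡ : ∀ {y} → 1 ≤ y → y ≤ h → s y + y ≡ suc N
  outerˡ {y} 1≤y y≤h = trans (cong (_+ y) sy≡z) z+y≡1+N
    where
    z = suc N ∸ y
    z+y≡1+N : z + y ≡ suc N
    z+y≡1+N = m∸n+n≡m (≤-trans y≤h (≤-trans (<⇒≤ h<N) (n≤1+n N)))
    e<z : e < z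
    e<z = +-cancelʳ-≤ y (suc e) z (begin
      suc e + y ≤⟨ +-monoʳ-≤ (suc e) y≤h ⟩
      suc e + h ≡⟨ cong suc e+h≡N ⟩
      suc N     ≡⟨ sym z+y≡1+N ⟩
      z + y     ∎)
      where open ≤-Reasoning
    sz≡y : s z ≡ y
    sz≡y = +-cancelʳ-≡ z (s z) y (trans (outerʳ e<z (∸-monoʳ-≤ (suc N) 1≤y)) (trans (sym z+y≡1+N) (+-comm z y)))
    sy≡z : s y ≡ z
    sy≡z = trans (cong s (sym sz≡y)) (s-involutive z)

  re≡h : r e ≡ h
  re≡h = trans (r-shift (proj₁ e-range) e<N)
    (+-cancelʳ-≡ (suc e) _ _ (trans (outerʳ ≤-refl e<N) (sym (trans (+-suc h e) 1+h+e≡1+N))))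

  k : ℕ
  k = r h

  rh≡k : r (r e) ≡ k
  rh≡k = cong r re≡h

  rk≡e : r k ≡ e
  rk≡e = trans (cong (λ x → r (r x)) (sym re≡h)) r³a≡a

  on-cycle : ∀ {w} → OnCycle r e w → w ≡ e ⊎ w ≡ h ⊎ w ≡ k
  on-cycle (inj₁ w≡e) = inj₁ w≡e
  on-cycle (inj₂ (inj₁ w≡re)) = inj₂ (inj₁ (trans w≡re re≡h))
  on-cycle (inj₂ (inj₂ w≡rre)) = inj₂ (inj₂ (trans w≡rre rh≡k))

  sk≡1+h : s k ≡ suc h
  sk≡1+h = trans (cong s (r-shift 1≤h h<N)) (s-involutive (suc h))

  k-range : InRange N k
  k-range = subst (InRange N) (sym (r-shift 1≤h h<N)) (s-range (s≤s z≤n , h<N))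

  -- the chord {k, h + 1} cannot be one of the outer chords, as those would force k = e
  not-outer : s k + k ≢ suc N
  not-outer sum≡ = a≢rra (trans (+-cancelˡ-≡ (suc h) e k (trans 1+h+e≡1+N (trans (sym sum≡) (cong (_+ k) sk≡1+h))))
                                (sym rh≡k))

  h<k : h < k
  h<k = ≰⇒> (λ k≤h → not-outer (outerˡ (proj₁ k-range) k≤h))

  k<e : k < e
  k<e = ≤∧≢⇒< (≮⇒≥ (λ e<k → not-outer (outerʳ e<k (proj₂ k-range)))) (λ k≡e → a≢rra (sym (trans rh≡k k≡e)))

  k<N : k < N
  k<N = <-trans k<e e<N

  middle : ∀ {y} → h < y → y ≤ k → s y + y ≡ suc (h + k)
  middle h<y y≤k = trans (arc sk≡1+h ≤-refl (proj₂ k-range) free h<y y≤k) (trans (+-suc k h) (cong suc (+-comm k h)))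
    where
    free : ∀ {i} → suc h ≤ i → i < k → Free i
    free h<i i<k = ≤-trans (s≤s z≤n) h<i , <-trans i<k k<N , λ on → [ <⇒≢ (<-trans i<k k<e)
                                                                    , [ <⇒≢ h<i ∘′ sym , <⇒≢ i<k ]′ ]′ (on-cycle on)

  se≡1+k : s e ≡ suc k
  se≡1+k = trans (cong s (sym (trans (sym (r-shift (proj₁ k-range) k<N)) rk≡e))) (s-involutive (suc k))

  inner : ∀ {y} → k < y → y ≤ e → s y + y ≡ suc (k + e)
  inner k<y y≤e = trans (arc se≡1+k ≤-refl (proj₂ e-range) free k<y y≤e) (trans (+-suc e k) (cong suc (+-comm e k)))
    where
    free : ∀ {i} → suc k ≤ i → i < e → Free i
    free k<i i<e = ≤-trans (s≤s z≤n) k<i , <-trans i<e e<N , λ on → [ <⇒≢ i<e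
                                                                  , [ <⇒≢ (<-trans h<k k<i) ∘′ sym , <⇒≢ k<i ∘′ sym ]′ ]′ (on-cycle on)

  -- an odd gap would leave its midpoint fixed by s
  even-gap : ∀ {lo top} → (∀ {y} → lo < y → y ≤ top → s y + y ≡ suc (lo + top)) → lo < top → top ≤ N →
             ∃[ u ] (1 ≤ u × top ≡ lo + 2 * u)
  even-gap {lo} {top} sum lo<top top≤N with parity (top ∸ lo)
  ... | zero , inj₁ gap≡0 = ⊥-elim (<⇒≢ (m<n⇒0<n∸m lo<top) (sym gap≡0))
  ... | suc u , inj₁ gap≡2u = suc u , s≤s z≤n , trans (sym (m+[n∸m]≡n (<⇒≤ lo<top))) (cong (lo +_) gap≡2u)
  ... | t , inj₂ gap≡1+2t = ⊥-elim (s-fixedPointFree (≤-trans (s≤s z≤n) lo<y , ≤-trans y≤top top≤N)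
                                      (+-cancelʳ-≡ y (s y) y (trans (sum lo<y y≤top) 1+lo+top≡y+y)))
    where
    y = lo + suc t
    top≡ : top ≡ lo + suc (2 * t)
    top≡ = trans (sym (m+[n∸m]≡n (<⇒≤ lo<top))) (cong (lo +_) gap≡1+2t)
    lo<y : lo < y
    lo<y = m<m+n lo z<s
    y≤top : y ≤ top
    y≤top = subst (y ≤_) (sym top≡) (+-monoʳ-≤ lo (s≤s (m≤m+n t (t + 0))))
    1+lo+top≡y+y : suc (lo + top) ≡ y + y
    1+lo+top≡y+y = trans (cong (λ x → suc (lo + x)) top≡) (odd-midpoint lo t)
      where
      odd-midpoint : ∀ lo t → suc (lo + (lo + suc (2 * t))) ≡ lo + suc t + (lo + suc t)
      odd-midpoint = solve-∀

  shape : ∃[ h ] ∃[ u ] ∃[ v ]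
    (1 ≤ h × 1 ≤ u × 1 ≤ v × N ≡ 2 * (h + u + v) × Chords N h (h + 2 * u) (h + 2 * u + 2 * v) s)
  shape with even-gap middle h<k (<⇒≤ k<N) | even-gap inner k<e (proj₂ e-range)
  ... | u , 1≤u , k≡ | v , 1≤v , e≡ =
    h , u , v , 1≤h , 1≤u , 1≤v , N≡ ,
    subst₂ (λ k′ e′ → Chords N h k′ e′ s) k≡ e≡′ (record { outerˡ = outerˡ ; outerʳ = outerʳ ; middle = middle ; inner = inner })
    where
    e≡′ : e ≡ h + 2 * u + 2 * v
    e≡′ = trans e≡ (cong (_+ 2 * v) k≡)
    N≡ : N ≡ 2 * (h + u + v)
    N≡ = trans (sym e+h≡N) (trans (cong (_+ h) e≡′) (arcs-total h u v))

-- the proposition's h and k, with u = (k − h) / 2 and v = (2n − h − k) / 2 both positive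
module Arcs (h₁ u₁ v₁ : ℕ) where

  h u v n k e N : ℕ
  h = suc h₁
  u = suc u₁
  v = suc v₁
  n = h + u + v
  k = h + 2 * u
  e = k + 2 * v
  N = 2 * n

  N≡e+h : N ≡ e + h
  N≡e+h = sym (arcs-total h u v)

  h<k : h < k
  h<k = m<m+n h z<s

  k<e : k < e
  k<e = m<m+n k z<s

  e<N : e < N
  e<N = subst (e <_) (sym N≡e+h) (m<m+n e z<s)

  k<N : k < N
  k<N = <-trans k<e e<N

  h<N : h < N
  h<N = <-trans h<k k<N

  N∸h≡e : N ∸ h ≡ e
  N∸h≡e = trans (cong (_∸ h) N≡e+h) (m+n∸n≡m e h)

  [k∸h]/2≡u : (k ∸ h) / 2 ≡ u
  [k∸h]/2≡u = trans (cong (_/ 2) (m+n∸m≡n h (2 * u))) (half-double u)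

  [N∸h∸k]/2≡v : (N ∸ h ∸ k) / 2 ≡ v
  [N∸h∸k]/2≡v = trans (cong (λ x → (x ∸ k) / 2) N∸h≡e) (trans (cong (_/ 2) (m+n∸m≡n k (2 * v))) (half-double v))

  σ₀Blocks : List (ℕ × ℕ)
  σ₀Blocks = Block 0 (suc N) h ++ Block h (suc k) u ++ Block k (suc e) v

  σ₀Pairs≡σ₀Blocks : σ₀Pairs n h k ≡ σ₀Blocks
  σ₀Pairs≡σ₀Blocks = cong₂ _++_ (cong (λ c → Block 0 c h) (+-comm N 1))
    (cong₂ _++_ (cong₂ (Block h) (+-comm k 1) [k∸h]/2≡u)
                (cong₂ (Block k) (trans (+-comm (N ∸ h) 1) (cong suc N∸h≡e)) [N∸h∸k]/2≡v))

  middle∈ : ∀ {x} → x ∈ entries (Block h (suc k) u) → h < x × x ≤ k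
  middle∈ x∈ = Data.Product.map₂ ≤-pred (∈-Block⇒between (s≤s (+-monoʳ-≤ h (m≤m+n u (u + 0)))) x∈)

  inner∈ : ∀ {x} → x ∈ entries (Block k (suc e) v) → k < x × x ≤ e
  inner∈ x∈ = Data.Product.map₂ ≤-pred (∈-Block⇒between (s≤s (+-monoʳ-≤ k (m≤m+n v (v + 0)))) x∈)

  outer∈ : ∀ {x} → x ∈ entries (Block 0 (suc N) h) → (1 ≤ x × x ≤ h) ⊎ (e < x × x ≤ N)
  outer∈ {x} x∈ with ∈-Block⇒InBlock (≤-trans (<⇒≤ h<N) (n≤1+n N)) x∈
  ... | inj₁ x∈ˡ = inj₁ x∈ˡ
  ... | inj₂ (1+N≤x+h , x<1+N) =
    inj₂ (+-cancelʳ-≤ h (suc e) x (subst (_≤ x + h) (cong suc N≡e+h) 1+N≤x+h) , ≤-pred x<1+N)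

  σ₀Blocks-unique : Unique (entries σ₀Blocks)
  σ₀Blocks-unique =
    Unique-entries-++ (Block 0 (suc N) h) _ (Block-unique 0 (suc N) h (s≤s 2h≤N))
      (Unique-entries-++ (Block h (suc k) u) _ (Block-unique h (suc k) u ≤-refl) (Block-unique k (suc e) v ≤-refl)
        (λ x∈₂ x∈₃ → <⇒≱ (proj₁ (inner∈ x∈₃)) (proj₂ (middle∈ x∈₂))))
      outer-disjoint
    where
    2h≤N : 2 * h ≤ N
    2h≤N = *-monoʳ-≤ 2 (≤-trans (m≤m+n h u) (m≤m+n (h + u) v))
    outer-disjoint : ∀ {x} → x ∈ entries (Block 0 (suc N) h) → x ∈ entries (Block h (suc k) u ++ Block k (suc e) v) → ⊥
    outer-disjoint x∈₁ x∈₂₃ with outer∈ x∈₁ | ∈-entries-++⁻ (Block h (suc k) u) _ x∈₂₃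
    ... | inj₁ (_ , x≤h) | inj₁ x∈₂ = <⇒≱ (proj₁ (middle∈ x∈₂)) x≤h
    ... | inj₁ (_ , x≤h) | inj₂ x∈₃ = <⇒≱ (<-trans h<k (proj₁ (inner∈ x∈₃))) x≤h
    ... | inj₂ (e<x , _) | inj₁ x∈₂ = <⇒≱ e<x (≤-trans (proj₂ (middle∈ x∈₂)) (<⇒≤ k<e))
    ... | inj₂ (e<x , _) | inj₂ x∈₃ = <⇒≱ e<x (proj₂ (inner∈ x∈₃))

  σ₀Blocks-range : All (InRange N) (entries σ₀Blocks)
  σ₀Blocks-range = All.tabulate in-range
    where
    in-range : ∀ {x} → x ∈ entries σ₀Blocks → InRange N x
    in-range x∈ with ∈-entries-++⁻ (Block 0 (suc N) h) _ x∈
    ... | inj₁ x∈₁ with outer∈ x∈₁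
    ...   | inj₁ (1≤x , x≤h) = 1≤x , ≤-trans x≤h (<⇒≤ h<N)
    ...   | inj₂ (e<x , x≤N) = ≤-trans (s≤s z≤n) e<x , x≤N
    in-range x∈ | inj₂ x∈₂₃ with ∈-entries-++⁻ (Block h (suc k) u) _ x∈₂₃
    ...   | inj₁ x∈₂ = ≤-trans (s≤s z≤n) (proj₁ (middle∈ x∈₂)) , ≤-trans (proj₂ (middle∈ x∈₂)) (<⇒≤ k<N)
    ...   | inj₂ x∈₃ = ≤-trans (s≤s z≤n) (proj₁ (inner∈ x∈₃)) , ≤-trans (proj₂ (inner∈ x∈₃)) (<⇒≤ e<N)

  σ₀Blocks-length : length σ₀Blocks ≡ n
  σ₀Blocks-length = begin
    length σ₀Blocks                                 ≡⟨ length-++ (Block 0 (suc N) h) ⟩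
    length (Block 0 (suc N) h) + length (Block h (suc k) u ++ Block k (suc e) v)
                                                    ≡⟨ cong₂ _+_ (length-Block 0 (suc N) h) (length-++ (Block h (suc k) u)) ⟩
    h + (length (Block h (suc k) u) + length (Block k (suc e) v))
                                                    ≡⟨ cong₂ (λ a b → h + (a + b)) (length-Block h (suc k) u) (length-Block k (suc e) v) ⟩
    h + (u + v)                                     ≡⟨ sym (+-assoc h u v) ⟩
    n                                               ∎
    where open ≡-Reasoning

  σ₀Blocks-chords : Chords N h k e (prodT σ₀Blocks)
  σ₀Blocks-chords = record
    { outerˡ = λ 1≤y y≤h → Block-reflect σ₀Blocks σ₀Blocks-unique ∈-++⁺ˡ h≤1+N (inj₁ (1≤y , y≤h))
    ; outerʳ = λ {y} e<y y≤N → Block-reflect σ₀Blocks σ₀Blocks-unique ∈-++⁺ˡ h≤1+N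
                 (inj₂ (subst (_≤ y + h) (cong suc (sym N≡e+h)) (+-monoˡ-≤ h e<y) , s≤s y≤N))
    ; middle = Block-arc-reflect σ₀Blocks σ₀Blocks-unique (∈-++⁺ʳ (Block 0 (suc N) h) ∘′ ∈-++⁺ˡ) (+-double h u)
    ; inner = Block-arc-reflect σ₀Blocks σ₀Blocks-unique
                (∈-++⁺ʳ (Block 0 (suc N) h) ∘′ ∈-++⁺ʳ (Block h (suc k) u)) (+-double k v)
    }
    where
    h≤1+N : h ≤ suc N
    h≤1+N = ≤-trans (<⇒≤ h<N) (n≤1+n N)

  ρBlocks : List (ℕ × ℕ)
  ρBlocks = Block 0 N h₁ ++ Block h k u₁ ++ Block k e v₁

  e∸v≡k+v : e ∸ v ≡ k + v
  e∸v≡k+v = trans (cong (_∸ v) (+-double k v)) (m+n∸n≡m (k + v) v)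

  ρPairs≡ρBlocks++ : ρPairs n h k ≡ ρBlocks ++ (k + v , k + v) ∷ []
  ρPairs≡ρBlocks++ = begin
    ρPairs n h k
      ≡⟨ cong₂ (λ a b → Block 0 N h₁ ++ Block h k (a ∸ 1) ++ b) [k∸h]/2≡u (cong₂ (Block k) N∸h≡e [N∸h∸k]/2≡v) ⟩
    Block 0 N h₁ ++ Block h k u₁ ++ Block k e v
      ≡⟨ cong (λ b → Block 0 N h₁ ++ Block h k u₁ ++ b) (Block-snoc k e v₁) ⟩
    Block 0 N h₁ ++ Block h k u₁ ++ Block k e v₁ ++ (k + v , e ∸ v) ∷ []
      ≡⟨ cong (λ b → Block 0 N h₁ ++ b) (sym (++-assoc (Block h k u₁) (Block k e v₁) _)) ⟩
    Block 0 N h₁ ++ (Block h k u₁ ++ Block k e v₁) ++ (k + v , e ∸ v) ∷ []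
      ≡⟨ sym (++-assoc (Block 0 N h₁) _ _) ⟩
    ρBlocks ++ (k + v , e ∸ v) ∷ []
      ≡⟨ cong (λ b → ρBlocks ++ (k + v , b) ∷ []) e∸v≡k+v ⟩
    ρBlocks ++ (k + v , k + v) ∷ []
      ∎
    where open ≡-Reasoning

  ρFun≡cyc3∘ρBlocks : ∀ y → ρFun n h k y ≡ cyc3 e h k (prodT ρBlocks y)
  ρFun≡cyc3∘ρBlocks y = cong₂ (λ a b → cyc3 a h k b) N∸h≡e
    (trans (cong (λ ps → prodT ps y) ρPairs≡ρBlocks++) (prodT-drop-trivial ρBlocks (k + v) y))

  k≡h+u+u : k ≡ h + u + u
  k≡h+u+u = +-double h u

  e≡k+v+v : e ≡ k + v + v
  e≡k+v+v = +-double k v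

  h<h+u : h < h + u
  h<h+u = m<m+n h z<s

  h+u<k : h + u < k
  h+u<k = subst (h + u <_) (sym k≡h+u+u) (m<m+n (h + u) z<s)

  k<k+v : k < k + v
  k<k+v = m<m+n k z<s

  k+v<e : k + v < e
  k+v<e = subst (k + v <_) (sym e≡k+v+v) (m<m+n (k + v) z<s)

  ρRegion : ℕ → Set
  ρRegion x = (1 ≤ x × x < h) ⊎ (e < x × x < N) ⊎ (h < x × x < k × x ≢ h + u) ⊎ (k < x × x < e × x ≢ k + v)

  outer′∈ : ∀ {x} → x ∈ entries (Block 0 N h₁) → (1 ≤ x × x < h) ⊎ (e < x × x < N)
  outer′∈ {x} x∈ with ∈-Block⇒InBlock (≤-trans (n≤1+n h₁) (<⇒≤ h<N)) x∈
  ... | inj₁ (0<x , x≤h₁) = inj₁ (0<x , s≤s x≤h₁)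
  ... | inj₂ (N≤x+h₁ , x<N) =
    inj₂ (+-cancelʳ-≤ h₁ (suc e) x (subst (_≤ x + h₁) (trans N≡e+h (+-suc e h₁)) N≤x+h₁) , x<N)

  middle′∈ : ∀ {x} → x ∈ entries (Block h k u₁) → h < x × x < k × x ≢ h + u
  middle′∈ = ∈-gapped-Block {h} {k} {u₁} k≡h+u+u

  inner′∈ : ∀ {x} → x ∈ entries (Block k e v₁) → k < x × x < e × x ≢ k + v
  inner′∈ = ∈-gapped-Block {k} {e} {v₁} e≡k+v+v

  ρRegion-range : ∀ {x} → ρRegion x → 1 ≤ x × x < N
  ρRegion-range (inj₁ (1≤x , x<h)) = 1≤x , <-trans x<h h<N
  ρRegion-range (inj₂ (inj₁ (e<x , x<N))) = ≤-trans (s≤s z≤n) e<x , x<N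
  ρRegion-range (inj₂ (inj₂ (inj₁ (h<x , x<k , _)))) = ≤-trans (s≤s z≤n) h<x , <-trans x<k k<N
  ρRegion-range (inj₂ (inj₂ (inj₂ (k<x , x<e , _)))) = ≤-trans (s≤s z≤n) k<x , <-trans x<e e<N

  ρBlocks∈ : ∀ {x} → x ∈ entries ρBlocks → ρRegion x
  ρBlocks∈ x∈ with ∈-entries-++⁻ (Block 0 N h₁) _ x∈
  ... | inj₁ x∈₁ = Data.Sum.map₂ inj₁ (outer′∈ x∈₁)
  ... | inj₂ x∈₂₃ with ∈-entries-++⁻ (Block h k u₁) _ x∈₂₃
  ...   | inj₁ x∈₂ = inj₂ (inj₂ (inj₁ (middle′∈ x∈₂)))
  ...   | inj₂ x∈₃ = inj₂ (inj₂ (inj₂ (inner′∈ x∈₃)))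

  ρBlocks-unique : Unique (entries ρBlocks)
  ρBlocks-unique =
    Unique-entries-++ (Block 0 N h₁) _ (Block-unique 0 N h₁ 2h₁<N)
      (Unique-entries-++ (Block h k u₁) _ (Block-unique h k u₁ h+2u₁<k) (Block-unique k e v₁ k+2v₁<e)
        (λ x∈₂ x∈₃ → <-asym (proj₁ (proj₂ (middle′∈ x∈₂))) (proj₁ (inner′∈ x∈₃))))
      outer-disjoint
    where
    2h₁<N : 2 * h₁ < N
    2h₁<N = <-≤-trans (*-monoʳ-< 2 (n<1+n h₁)) (*-monoʳ-≤ 2 (≤-trans (m≤m+n h u) (m≤m+n (h + u) v)))
    h+2u₁<k : h + 2 * u₁ < k
    h+2u₁<k = +-monoʳ-< h (*-monoʳ-< 2 ≤-refl)
    k+2v₁<e : k + 2 * v₁ < e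
    k+2v₁<e = +-monoʳ-< k (*-monoʳ-< 2 ≤-refl)
    outer-disjoint : ∀ {x} → x ∈ entries (Block 0 N h₁) → x ∈ entries (Block h k u₁ ++ Block k e v₁) → ⊥
    outer-disjoint x∈₁ x∈₂₃ with outer′∈ x∈₁ | ∈-entries-++⁻ (Block h k u₁) _ x∈₂₃
    ... | inj₁ (_ , x<h) | inj₁ x∈₂ = <-asym x<h (proj₁ (middle′∈ x∈₂))
    ... | inj₁ (_ , x<h) | inj₂ x∈₃ = <-asym x<h (<-trans h<k (proj₁ (inner′∈ x∈₃)))
    ... | inj₂ (e<x , _) | inj₁ x∈₂ = <-asym e<x (<-trans (proj₁ (proj₂ (middle′∈ x∈₂))) k<e)
    ... | inj₂ (e<x , _) | inj₂ x∈₃ = <-asym e<x (proj₁ (proj₂ (inner′∈ x∈₃)))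

  h<e : h < e
  h<e = <-trans h<k k<e

  ρBlocks-fixes : ∀ {p} → ¬ ρRegion p → prodT ρBlocks p ≡ p
  ρBlocks-fixes ¬region = prodT-fixes ρBlocks (¬region ∘′ ρBlocks∈)

  h∉ : ¬ ρRegion h
  h∉ (inj₁ (_ , h<h)) = <-irrefl refl h<h
  h∉ (inj₂ (inj₁ (e<h , _))) = <-asym e<h h<e
  h∉ (inj₂ (inj₂ (inj₁ (h<h , _)))) = <-irrefl refl h<h
  h∉ (inj₂ (inj₂ (inj₂ (k<h , _)))) = <-asym k<h h<k

  k∉ : ¬ ρRegion k
  k∉ (inj₁ (_ , k<h)) = <-asym k<h h<k
  k∉ (inj₂ (inj₁ (e<k , _))) = <-asym e<k k<e
  k∉ (inj₂ (inj₂ (inj₁ (_ , k<k , _)))) = <-irrefl refl k<k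
  k∉ (inj₂ (inj₂ (inj₂ (k<k , _)))) = <-irrefl refl k<k

  e∉ : ¬ ρRegion e
  e∉ (inj₁ (_ , e<h)) = <-asym e<h h<e
  e∉ (inj₂ (inj₁ (e<e , _))) = <-irrefl refl e<e
  e∉ (inj₂ (inj₂ (inj₁ (_ , e<k , _)))) = <-asym e<k k<e
  e∉ (inj₂ (inj₂ (inj₂ (_ , e<e , _)))) = <-irrefl refl e<e

  N∉ : ¬ ρRegion N
  N∉ (inj₁ (_ , N<h)) = <-asym N<h h<N
  N∉ (inj₂ (inj₁ (_ , N<N))) = <-irrefl refl N<N
  N∉ (inj₂ (inj₂ (inj₁ (_ , N<k , _)))) = <-asym N<k k<N
  N∉ (inj₂ (inj₂ (inj₂ (_ , N<e , _)))) = <-asym N<e e<N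

  h+u∉ : ¬ ρRegion (h + u)
  h+u∉ (inj₁ (_ , h+u<h)) = <-asym h+u<h h<h+u
  h+u∉ (inj₂ (inj₁ (e<h+u , _))) = <-asym e<h+u (<-trans h+u<k k<e)
  h+u∉ (inj₂ (inj₂ (inj₁ (_ , _ , h+u≢h+u)))) = h+u≢h+u refl
  h+u∉ (inj₂ (inj₂ (inj₂ (k<h+u , _)))) = <-asym k<h+u h+u<k

  k+v∉ : ¬ ρRegion (k + v)
  k+v∉ (inj₁ (_ , k+v<h)) = <-asym k+v<h (<-trans h<k k<k+v)
  k+v∉ (inj₂ (inj₁ (e<k+v , _))) = <-asym e<k+v k+v<e
  k+v∉ (inj₂ (inj₂ (inj₁ (_ , k+v<k , _)))) = <-asym k+v<k k<k+v
  k+v∉ (inj₂ (inj₂ (inj₂ (_ , _ , k+v≢k+v)))) = k+v≢k+v refl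

  ρBlocks-outerˡ : ∀ {y} → 1 ≤ y → y < h → prodT ρBlocks y + y ≡ N
  ρBlocks-outerˡ 1≤y y<h =
    Block-reflect ρBlocks ρBlocks-unique ∈-++⁺ˡ (≤-trans (n≤1+n h₁) (<⇒≤ h<N)) (inj₁ (1≤y , ≤-pred y<h))

  ρBlocks-outerʳ : ∀ {y} → e < y → y < N → prodT ρBlocks y + y ≡ N
  ρBlocks-outerʳ {y} e<y y<N =
    Block-reflect ρBlocks ρBlocks-unique ∈-++⁺ˡ (≤-trans (n≤1+n h₁) (<⇒≤ h<N))
      (inj₂ (subst (_≤ y + h₁) (sym (trans N≡e+h (+-suc e h₁))) (+-monoˡ-≤ h₁ e<y) , y<N))

  ρBlocks-middle : ∀ {y} → h < y → y < k → prodT ρBlocks y + y ≡ h + k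
  ρBlocks-middle = Block-gap-reflect {h} {k} {u₁} ρBlocks ρBlocks-unique (∈-++⁺ʳ (Block 0 N h₁) ∘′ ∈-++⁺ˡ)
    k≡h+u+u (h+u∉ ∘′ ρBlocks∈)

  ρBlocks-inner : ∀ {y} → k < y → y < e → prodT ρBlocks y + y ≡ k + e
  ρBlocks-inner = Block-gap-reflect {k} {e} {v₁} ρBlocks ρBlocks-unique
    (∈-++⁺ʳ (Block 0 N h₁) ∘′ ∈-++⁺ʳ (Block h k u₁)) e≡k+v+v (k+v∉ ∘′ ρBlocks∈)

  cyc3-fixes-below-h : ∀ {z} → z < h → cyc3 e h k z ≡ z
  cyc3-fixes-below-h z<h = cyc3-fixes (<⇒≢ (<-trans z<h h<e)) (<⇒≢ z<h) (<⇒≢ (<-trans z<h h<k))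

  cyc3-fixes-middle : ∀ {z} → h < z → z < k → cyc3 e h k z ≡ z
  cyc3-fixes-middle h<z z<k = cyc3-fixes (<⇒≢ (<-trans z<k k<e)) (>⇒≢ h<z) (<⇒≢ z<k)

  cyc3-fixes-inner : ∀ {z} → k < z → z < e → cyc3 e h k z ≡ z
  cyc3-fixes-inner k<z z<e = cyc3-fixes (<⇒≢ z<e) (>⇒≢ (<-trans h<k k<z)) (>⇒≢ k<z)

  cyc3-fixes-above-e : ∀ {z} → e < z → cyc3 e h k z ≡ z
  cyc3-fixes-above-e e<z = cyc3-fixes (>⇒≢ e<z) (>⇒≢ (<-trans h<e e<z)) (>⇒≢ (<-trans k<e e<z))

  ρFun-N : ρFun n h k N ≡ N
  ρFun-N = trans (ρFun≡cyc3∘ρBlocks N) (trans (cong (cyc3 e h k) (ρBlocks-fixes N∉)) (cyc3-fixes-above-e e<N))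

  ρFun-shift : ∀ {f} → Chords N h k e f → ∀ {y} → 1 ≤ y → y < N → ρFun n h k y ≡ f (suc y)
  ρFun-shift {f} F {y} 1≤y y<N = trans (ρFun≡cyc3∘ρBlocks y) (by-region (<-cmp y h))
    where
    module F = Chords F
    R = prodT ρBlocks
    by-region : Tri (y < h) (y ≡ h) (h < y) → cyc3 e h k (R y) ≡ f (suc y)
    by-region (tri< y<h _ _) = let R+y≡N = ρBlocks-outerˡ 1≤y y<h in
      trans (cyc3-fixes-above-e (reflect-above (trans R+y≡N N≡e+h) y<h)) (same-partner R+y≡N (F.outerˡ (s≤s z≤n) y<h))
    by-region (tri≈ _ refl _) =
      trans (cong (cyc3 e h k) (ρBlocks-fixes h∉)) (trans (cyc3-second (<⇒≢ h<e))
        (same-partner (+-comm k h) (F.middle (n<1+n h) h<k)))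
    by-region (tri> _ _ h<y) with <-cmp y k
    ... | tri< y<k _ _ = let R+y≡h+k = ρBlocks-middle h<y y<k in
      trans (cyc3-fixes-middle (reflect-above R+y≡h+k y<k) (reflect-below R+y≡h+k h<y))
            (same-partner R+y≡h+k (F.middle (<-trans h<y (n<1+n y)) y<k))
    ... | tri≈ _ refl _ =
      trans (cong (cyc3 e h k) (ρBlocks-fixes k∉)) (trans (cyc3-third (<⇒≢ k<e) (>⇒≢ h<k))
        (same-partner (+-comm e k) (F.inner (n<1+n k) k<e)))
    ... | tri> _ _ k<y with <-cmp y e
    ...   | tri< y<e _ _ = let R+y≡k+e = ρBlocks-inner k<y y<e in
      trans (cyc3-fixes-inner (reflect-above R+y≡k+e y<e) (reflect-below R+y≡k+e k<y))
            (same-partner R+y≡k+e (F.inner (<-trans k<y (n<1+n y)) y<e))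
    ...   | tri≈ _ refl _ =
      trans (cong (cyc3 e h k) (ρBlocks-fixes e∉)) (trans (cyc3-first e h k)
        (same-partner (trans (+-comm h e) (sym N≡e+h)) (F.outerʳ (n<1+n e) e<N)))
    ...   | tri> _ _ e<y = let R+y≡N = ρBlocks-outerʳ e<y y<N in
      trans (cyc3-fixes-below-h (reflect-below (trans R+y≡N N≡e+h) e<y))
            (same-partner R+y≡N (F.outerʳ (<-trans e<y (n<1+n y)) y<N))

  n<e : n < e
  n<e = subst (n <_) (sym (arcs-excess h u v)) (m<m+n n z<s)
    where
    arcs-excess : ∀ h u v → h + 2 * u + 2 * v ≡ h + u + v + (u + v)
    arcs-excess = solve-∀

  N≡n+n : N ≡ n + n
  N≡n+n = cong (n +_) (+-identityʳ n)

  h+k≡ : h + k ≡ (h + u) + (h + u)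
  h+k≡ = +-double-both h u

  k+e≡ : k + e ≡ (k + v) + (k + v)
  k+e≡ = +-double-both k v

  module _ {f : ℕ → ℕ} {y : ℕ} where
    not-fixed : f (suc y) + suc y ≡ suc (n + n) → y ≢ n → y ≢ h + u → y ≢ k + v →
                f (suc y) ≡ y ⇔ (y ≡ h + u ⊎ y ≡ k + v)
    not-fixed sum y≢n y≢₁ y≢₂ =
      mk⇔ (⊥-elim ∘′ y≢n ∘′ Equivalence.to (partner-is-predecessor sum)) [ ⊥-elim ∘′ y≢₁ , ⊥-elim ∘′ y≢₂ ]′

    fixed-at-middle : f (suc y) + suc y ≡ suc ((h + u) + (h + u)) → y ≢ k + v →
                      f (suc y) ≡ y ⇔ (y ≡ h + u ⊎ y ≡ k + v)
    fixed-at-middle sum y≢₂ = mk⇔ (inj₁ ∘′ Equivalence.to P) [ Equivalence.from P , ⊥-elim ∘′ y≢₂ ]′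
      where P = partner-is-predecessor sum

    fixed-at-inner : f (suc y) + suc y ≡ suc ((k + v) + (k + v)) → y ≢ h + u →
                     f (suc y) ≡ y ⇔ (y ≡ h + u ⊎ y ≡ k + v)
    fixed-at-inner sum y≢₁ = mk⇔ (inj₂ ∘′ Equivalence.to P) [ ⊥-elim ∘′ y≢₁ , Equivalence.from P ]′
      where P = partner-is-predecessor sum

  shift-fixed : ∀ {f} → Chords N h k e f → ∀ {y} → y < N → f (suc y) ≡ y ⇔ (y ≡ h + u ⊎ y ≡ k + v)
  shift-fixed {f} F {y} y<N with y <? h
  ... | yes y<h = not-fixed {f} (trans (F.outerˡ (s≤s z≤n) y<h) (cong suc N≡n+n))
      (<⇒≢ (<-≤-trans y<h (≤-trans (m≤m+n h u) (m≤m+n (h + u) v)))) (<⇒≢ (<-trans y<h h<h+u))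
      (<⇒≢ (<-trans y<h (<-trans h<k k<k+v)))
    where module F = Chords F
  ... | no y≮h with y <? k
  ...   | yes y<k = fixed-at-middle {f} (trans (F.middle (s≤s (≮⇒≥ y≮h)) y<k) (cong suc h+k≡)) (<⇒≢ (<-trans y<k k<k+v))
    where module F = Chords F
  ...   | no y≮k with y <? e
  ...     | yes y<e = fixed-at-inner {f} (trans (F.inner (s≤s (≮⇒≥ y≮k)) y<e) (cong suc k+e≡))
                        (>⇒≢ (<-≤-trans h+u<k (≮⇒≥ y≮k)))
    where module F = Chords F
  ...     | no y≮e = not-fixed {f} (trans (F.outerʳ (s≤s (≮⇒≥ y≮e)) y<N) (cong suc N≡n+n))
                       (>⇒≢ (<-≤-trans n<e (≮⇒≥ y≮e))) (>⇒≢ (<-≤-trans (<-trans h+u<k k<e) (≮⇒≥ y≮e)))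
                       (>⇒≢ (<-≤-trans k+v<e (≮⇒≥ y≮e)))
    where module F = Chords F

  [k+h]/2≡h+u : (k + h) / 2 ≡ h + u
  [k+h]/2≡h+u = trans (cong (_/ 2) (*-double-around h u)) (half-double (h + u))

  [N∸h+k]/2≡k+v : (N ∸ h + k) / 2 ≡ k + v
  [N∸h+k]/2≡k+v = trans (cong (λ x → (x + k) / 2) N∸h≡e) (trans (cong (_/ 2) (*-double-around k v)) (half-double (k + v)))

  admissible : Admissible n h k
  admissible = s≤s z≤n , h≤n∸2 , h<k , subst (k <_) (sym N∸h≡e) k<e , same-parity
    where
    h≤n∸2 : h ≤ n ∸ 2
    h≤n∸2 = subst (h ≤_) (sym (trans (cong (_∸ 2) (two-plus h u₁ v₁)) (m+n∸m≡n 2 (h + u₁ + v₁))))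
                  (≤-trans (m≤m+n h u₁) (m≤m+n (h + u₁) v₁))
      where
      two-plus : ∀ h u₁ v₁ → h + suc u₁ + suc v₁ ≡ 2 + (h + u₁ + v₁)
      two-plus = solve-∀
    same-parity : h % 2 ≡ k % 2
    same-parity = sym (trans (cong (λ x → (h + x) % 2) (*-comm 2 u)) ([m+kn]%n≡m%n h u 2))

Admissible⇒Arcs : ∀ {n h k} → Admissible n h k →
  ∃[ h₁ ] ∃[ u₁ ] ∃[ v₁ ] (h ≡ suc h₁ × k ≡ Arcs.k h₁ u₁ v₁ × n ≡ Arcs.n h₁ u₁ v₁)
Admissible⇒Arcs {n} {suc h₁} {k} (_ , _ , h<k , k<2n∸h , same-parity) with parity (k ∸ suc h₁)
... | zero , inj₁ gap≡0 = ⊥-elim (<⇒≢ (m<n⇒0<n∸m h<k) (sym gap≡0))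
... | t , inj₂ gap≡odd = ⊥-elim (suc-parity (suc h₁) (trans (sym k%2≡) (sym same-parity)))
  where
  k%2≡ : k % 2 ≡ suc (suc h₁) % 2
  k%2≡ = trans (cong (_% 2) (trans (sym (m+[n∸m]≡n (<⇒≤ h<k))) (trans (cong (suc h₁ +_) gap≡odd) (odd-shift h₁ t))))
               ([m+kn]%n≡m%n (suc (suc h₁)) t 2)
    where
    odd-shift : ∀ h₁ t → suc h₁ + suc (2 * t) ≡ suc (suc h₁) + t * 2
    odd-shift = solve-∀
... | suc u₁ , inj₁ gap≡2u = h₁ , u₁ , n ∸ suc (h + u) , refl , k≡ , n≡
  where
  h = suc h₁
  u = suc u₁
  k≡ : k ≡ h + 2 * u
  k≡ = trans (sym (m+[n∸m]≡n (<⇒≤ h<k))) (cong (h +_) gap≡2u)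
  h<2n : h < 2 * n
  h<2n = m∸n≢0⇒n<m (>⇒≢ (≤-<-trans z≤n k<2n∸h))
  h+u<n : h + u < n
  h+u<n = *-cancelˡ-< 2 (h + u) n (begin-strict
    2 * (h + u)       ≡⟨ sym (*-double-around h u) ⟩
    h + 2 * u + h     ≡⟨ cong (_+ h) (sym k≡) ⟩
    k + h             <⟨ +-monoˡ-< h k<2n∸h ⟩
    2 * n ∸ h + h     ≡⟨ m∸n+n≡m (<⇒≤ h<2n) ⟩
    2 * n             ∎)
    where open ≤-Reasoning
  n≡ : n ≡ h + u + suc (n ∸ suc (h + u))
  n≡ = trans (sym (m+[n∸m]≡n h+u<n)) (sym (+-suc (h + u) _))

toFin : ∀ {m y} → InRange m y → Fin m
toFin {y = suc y} (_ , y<m) = fromℕ< y<m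

label-toFin : ∀ {m y} (y∈ : InRange m y) → label (toFin y∈) ≡ y
label-toFin {y = suc y} (_ , y<m) = cong suc (toℕ-fromℕ< y<m)

label∈ : ∀ {m} (x : Fin m) → InRange m (label x)
label∈ x = s≤s z≤n , toℕ<n x

label-injective : ∀ {m} {x y : Fin m} → label x ≡ label y → x ≡ y
label-injective eq = toℕ-injective (suc-injective eq)

Preserves : ℕ → (ℕ → ℕ) → Set
Preserves m f = ∀ {y} → InRange m y → InRange m (f y)

onLabels : ∀ {m} (f : ℕ → ℕ) → Preserves m f → Fin m → Fin m
onLabels f f-range x = toFin (f-range (label∈ x))

label-onLabels : ∀ {m} (f : ℕ → ℕ) (f-range : Preserves m f) (x : Fin m) → label (onLabels f f-range x) ≡ f (label x)
label-onLabels f f-range x = label-toFin (f-range (label∈ x))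

permutationOnLabels : ∀ {m} (f g : ℕ → ℕ) (f-range : Preserves m f) (g-range : Preserves m g) →
  (∀ {y} → InRange m y → f (g y) ≡ y) → (∀ {y} → InRange m y → g (f y) ≡ y) → Permutation′ m
permutationOnLabels f g f-range g-range f∘g g∘f = permutation (onLabels f f-range) (onLabels g g-range)
  (λ x → label-injective (trans (label-onLabels f f-range _) (trans (cong f (label-onLabels g g-range x)) (f∘g (label∈ x)))))
  (λ x → label-injective (trans (label-onLabels g g-range _) (trans (cong g (label-onLabels f f-range x)) (g∘f (label∈ x)))))

disjointProduct : ∀ m ps → Unique (entries ps) → All (InRange m) (entries ps) → Permutation′ m
disjointProduct m ps u ps∈ = permutationOnLabels (prodT ps) (prodT ps) range range
  (λ {y} _ → prodT-involutive ps u y) (λ {y} _ → prodT-involutive ps u y)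
  where
  range : Preserves m (prodT ps)
  range = prodT-preserves ps u ps∈

disjointProduct-label : ∀ m ps u ps∈ → Represents (disjointProduct m ps u ps∈ ⟨$⟩ʳ_) (prodT ps)
disjointProduct-label m ps u ps∈ = label-onLabels (prodT ps) (prodT-preserves ps u ps∈)

disjointProduct-type : ∀ m ps u ps∈ → IsProdDisjTransp m (length ps) (disjointProduct m ps u ps∈)
disjointProduct-type m ps u ps∈ = ps , refl , ps∈ , u , disjointProduct-label m ps u ps∈

rot⁻¹ : ℕ → ℕ → ℕ
rot⁻¹ m y with y ≟ m
... | yes _ = 1
... | no _ = suc y

rot-range : ∀ {m} → Preserves m (rot m)
rot-range {y = suc zero} (_ , 1≤m) = 1≤m , ≤-refl
rot-range {y = suc (suc j)} (_ , y≤m) = s≤s z≤n , ≤-trans (n≤1+n (suc j)) y≤m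

rot⁻¹-range : ∀ {m} → Preserves m (rot⁻¹ m)
rot⁻¹-range {m} {y} (1≤y , y≤m) with y ≟ m
... | yes _ = ≤-refl , ≤-trans 1≤y y≤m
... | no y≢m = s≤s z≤n , ≤∧≢⇒< y≤m y≢m

rot∘rot⁻¹ : ∀ {m y} → InRange m y → rot m (rot⁻¹ m y) ≡ y
rot∘rot⁻¹ {m} {y} (1≤y , _) with y ≟ m
... | yes y≡m = sym y≡m
rot∘rot⁻¹ {m} {suc y} (1≤y , _) | no _ = refl

rot⁻¹∘rot : ∀ {m y} → InRange m y → rot⁻¹ m (rot m y) ≡ y
rot⁻¹∘rot {m} {suc zero} _ with m ≟ m
... | yes _ = refl
... | no m≢m = ⊥-elim (m≢m refl)
rot⁻¹∘rot {m} {suc (suc j)} (_ , y≤m) with suc j ≟ m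
... | yes j+1≡m = ⊥-elim (<-irrefl j+1≡m y≤m)
... | no _ = refl

rotation : ∀ m → Permutation′ m
rotation m = permutationOnLabels (rot m) (rot⁻¹ m) rot-range rot⁻¹-range rot∘rot⁻¹ rot⁻¹∘rot

-- Realising the three special 4-tuples

module Construction (h₁ u₁ v₁ : ℕ) where
  open Arcs h₁ u₁ v₁

  S₀ : ℕ → ℕ
  S₀ = prodT σ₀Blocks

  S₀-range : Preserves N S₀
  S₀-range = prodT-preserves σ₀Blocks σ₀Blocks-unique σ₀Blocks-range

  S₀1≡N : S₀ 1 ≡ N
  S₀1≡N = +-cancelʳ-≡ 1 (S₀ 1) N (trans (Chords.outerˡ σ₀Blocks-chords ≤-refl (s≤s z≤n)) (+-comm 1 N))

  ρFun∘rot∘S₀ : ∀ {y} → InRange N y → ρFun n h k (rot N (S₀ y)) ≡ y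
  ρFun∘rot∘S₀ {y} y∈ = go (S₀ y) refl (S₀-range y∈)
    where
    go : ∀ z → S₀ y ≡ z → InRange N z → ρFun n h k (rot N z) ≡ y
    go (suc zero) S₀y≡1 _ =
      trans ρFun-N (sym (trans (sym (prodT-involutive σ₀Blocks σ₀Blocks-unique y)) (trans (cong S₀ S₀y≡1) S₀1≡N)))
    go (suc (suc j)) S₀y≡z (_ , z≤N) =
      trans (ρFun-shift σ₀Blocks-chords (s≤s z≤n) z≤N)
            (trans (cong S₀ (sym S₀y≡z)) (prodT-involutive σ₀Blocks σ₀Blocks-unique y))

  e≢h : e ≢ h
  e≢h = >⇒≢ h<e

  h≢k : h ≢ k
  h≢k = <⇒≢ h<k

  e≢k : e ≢ k
  e≢k = >⇒≢ k<e

  Corner : ℕ → Set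
  Corner x = x ≡ e ⊎ x ≡ h ⊎ x ≡ k

  corner-range : ∀ {x} → Corner x → 1 ≤ x × x < N
  corner-range (inj₁ refl) = ≤-trans (s≤s z≤n) h<e , e<N
  corner-range (inj₂ (inj₁ refl)) = s≤s z≤n , h<N
  corner-range (inj₂ (inj₂ refl)) = ≤-trans (s≤s z≤n) h<k , k<N

  corner-∉ρBlocks : ∀ {x} → Corner x → x ∉ entries ρBlocks
  corner-∉ρBlocks (inj₁ refl) = e∉ ∘′ ρBlocks∈
  corner-∉ρBlocks (inj₂ (inj₁ refl)) = h∉ ∘′ ρBlocks∈
  corner-∉ρBlocks (inj₂ (inj₂ refl)) = k∉ ∘′ ρBlocks∈


  -- τ = p, and σ₁ contributes the transposition q completing the 3-cycle (e h k)
  record Split (p : ℕ × ℕ) : Set where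
    field
      q          : ℕ × ℕ
      splits     : ∀ z → swapℕ (proj₁ p) (proj₂ p) (swapℕ (proj₁ q) (proj₂ q) z) ≡ cyc3 e h k z
      p-distinct : proj₁ p ≢ proj₂ p
      q-distinct : proj₁ q ≢ proj₂ q
      p-corners  : All Corner (entries (p ∷ []))
      q-corners  : All Corner (entries (q ∷ []))

  split : ∀ {p} → p ∈ (h , k) ∷ (h , e) ∷ (k , e) ∷ [] → Split p
  split (here refl) = record
    { q = e , k ; splits = λ z → sym (proj₁ (cyc3-splits e≢h h≢k e≢k z))
    ; p-distinct = h≢k ; q-distinct = e≢k
    ; p-corners = inj₂ (inj₁ refl) ∷ inj₂ (inj₂ refl) ∷ [] ; q-corners = inj₁ refl ∷ inj₂ (inj₂ refl) ∷ [] }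
  split (there (here refl)) = record
    { q = h , k ; splits = λ z → sym (proj₁ (proj₂ (cyc3-splits e≢h h≢k e≢k z)))
    ; p-distinct = e≢h ∘′ sym ; q-distinct = h≢k
    ; p-corners = inj₂ (inj₁ refl) ∷ inj₁ refl ∷ [] ; q-corners = inj₂ (inj₁ refl) ∷ inj₂ (inj₂ refl) ∷ [] }
  split (there (there (here refl))) = record
    { q = e , h ; splits = λ z → sym (proj₂ (proj₂ (cyc3-splits e≢h h≢k e≢k z)))
    ; p-distinct = e≢k ∘′ sym ; q-distinct = e≢h
    ; p-corners = inj₂ (inj₂ refl) ∷ inj₁ refl ∷ [] ; q-corners = inj₁ refl ∷ inj₂ (inj₁ refl) ∷ [] }

  module _ {p : ℕ × ℕ} (P : Split p) where
    open Split P

    σ₁Pairs : List (ℕ × ℕ)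
    σ₁Pairs = ρBlocks ++ q ∷ []

    σ₁Pairs-unique : Unique (entries σ₁Pairs)
    σ₁Pairs-unique = Unique-entries-++ ρBlocks (q ∷ []) ρBlocks-unique ((q-distinct ∷ []) ∷ [] ∷ [])
      (λ x∈ρ x∈q → corner-∉ρBlocks (All.lookup q-corners x∈q) x∈ρ)

    σ₁Pairs-below-N : ∀ {x} → x ∈ entries σ₁Pairs → 1 ≤ x × x < N
    σ₁Pairs-below-N x∈ with ∈-entries-++⁻ ρBlocks (q ∷ []) x∈
    ... | inj₁ x∈ρ = ρRegion-range (ρBlocks∈ x∈ρ)
    ... | inj₂ x∈q = corner-range (All.lookup q-corners x∈q)

    σ₁Pairs-length : length σ₁Pairs ≡ n ∸ 2
    σ₁Pairs-length = begin
      length σ₁Pairs                 ≡⟨ length-++ ρBlocks ⟩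
      length ρBlocks + 1             ≡⟨ cong (_+ 1) (trans (length-++ (Block 0 N h₁))
                                          (cong₂ _+_ (length-Block 0 N h₁) (trans (length-++ (Block h k u₁))
                                            (cong₂ _+_ (length-Block h k u₁) (length-Block k e v₁))))) ⟩
      h₁ + (u₁ + v₁) + 1             ≡⟨ sym (m+n∸m≡n 2 _) ⟩
      2 + (h₁ + (u₁ + v₁) + 1) ∸ 2   ≡⟨ cong (_∸ 2) (count-σ₁ h₁ u₁ v₁) ⟩
      n ∸ 2                          ∎
      where
      open ≡-Reasoning
      count-σ₁ : ∀ h₁ u₁ v₁ → 2 + (h₁ + (u₁ + v₁) + 1) ≡ suc h₁ + suc u₁ + suc v₁
      count-σ₁ = solve-∀

    σ₁Pairs-range : All (InRange N) (entries σ₁Pairs)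
    σ₁Pairs-range = All.tabulate (Data.Product.map₂ <⇒≤ ∘′ σ₁Pairs-below-N)

    p-unique : Unique (entries (p ∷ []))
    p-unique = (p-distinct ∷ []) ∷ [] ∷ []

    p-range : All (InRange N) (entries (p ∷ []))
    p-range = All.map (Data.Product.map₂ <⇒≤ ∘′ corner-range) p-corners

    σ₀-perm σ₁-perm τ-perm : Permutation′ N
    σ₀-perm = disjointProduct N σ₀Blocks σ₀Blocks-unique σ₀Blocks-range
    σ₁-perm = disjointProduct N σ₁Pairs σ₁Pairs-unique σ₁Pairs-range
    τ-perm = disjointProduct N (p ∷ []) p-unique p-range

    σ₁τ-ρFun : ∀ z → swapℕ (proj₁ p) (proj₂ p) (prodT σ₁Pairs z) ≡ ρFun n h k z
    σ₁τ-ρFun z = trans (cong (swapℕ (proj₁ p) (proj₂ p)) (prodT-++ ρBlocks (q ∷ []) z))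
                       (trans (splits (prodT ρBlocks z)) (sym (ρFun≡cyc3∘ρBlocks z)))

    label-σ₀ : Represents (σ₀-perm ⟨$⟩ʳ_) S₀
    label-σ₀ = disjointProduct-label N σ₀Blocks σ₀Blocks-unique σ₀Blocks-range

    label-σ₁τ : ∀ x → label (τ-perm ⟨$⟩ʳ (σ₁-perm ⟨$⟩ʳ x)) ≡ ρFun n h k (label x)
    label-σ₁τ x = trans (disjointProduct-label N (p ∷ []) p-unique p-range (σ₁-perm ⟨$⟩ʳ x))
      (trans (cong (swapℕ (proj₁ p) (proj₂ p)) (disjointProduct-label N σ₁Pairs σ₁Pairs-unique σ₁Pairs-range x))
             (σ₁τ-ρFun (label x)))

    special : Special n
    special = record
      { σ₀ = σ₀-perm ; σ∞ = rotation N ; σ₁ = σ₁-perm ; τ = τ-perm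
      ; σ₀-type = subst (λ l → IsProdDisjTransp N l σ₀-perm) σ₀Blocks-length (disjointProduct-type N σ₀Blocks _ _)
      ; σ∞-def = label-onLabels (rot N) rot-range
      ; σ₁-type = subst (λ l → IsProdDisjTransp N l σ₁-perm) σ₁Pairs-length (disjointProduct-type N σ₁Pairs _ _)
      ; τ-type = disjointProduct-type N (p ∷ []) _ _
      ; relation = λ x → label-injective (begin
          label (τ-perm ⟨$⟩ʳ (σ₁-perm ⟨$⟩ʳ (rotation N ⟨$⟩ʳ (σ₀-perm ⟨$⟩ʳ x))))
            ≡⟨ label-σ₁τ _ ⟩
          ρFun n h k (label (rotation N ⟨$⟩ʳ (σ₀-perm ⟨$⟩ʳ x)))
            ≡⟨ cong (ρFun n h k) (trans (label-onLabels (rot N) rot-range _) (cong (rot N) (label-σ₀ x))) ⟩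
          ρFun n h k (rot N (S₀ (label x)))
            ≡⟨ ρFun∘rot∘S₀ (label∈ x) ⟩
          label x ∎)
      ; σ₁-fix = λ x lx≡N → trans (disjointProduct-label N σ₁Pairs σ₁Pairs-unique σ₁Pairs-range x)
          (trans (cong (prodT σ₁Pairs) lx≡N) (prodT-fixes σ₁Pairs (λ N∈ → <-irrefl refl (proj₂ (σ₁Pairs-below-N N∈)))))
      ; τ-fix = λ x lx≡N → trans (disjointProduct-label N (p ∷ []) p-unique p-range x)
          (trans (cong (prodT (p ∷ [])) lx≡N)
            (prodT-fixes (p ∷ []) (λ N∈ → <-irrefl refl (proj₂ (corner-range (All.lookup p-corners N∈))))))
      }
      where open ≡-Reasoning

    realisation : Σ (Special n) λ S →
      Represents (Special.τ S ⟨$⟩ʳ_) (prodT (p ∷ [])) ×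
      Represents (Special.σ₀ S ⟨$⟩ʳ_) (prodT (σ₀Pairs n h k)) ×
      Represents (σ₁τ S) (ρFun n h k)
    realisation = special , disjointProduct-label N (p ∷ []) p-unique p-range
      , (λ x → trans (label-σ₀ x) (cong (λ ps → prodT ps (label x)) (sym σ₀Pairs≡σ₀Blocks)))
      , label-σ₁τ

realisations : (n h k : ℕ) → 2 ≤ n → Admissible n h k →
  (p : ℕ × ℕ) → p ∈ ((h , k) ∷ (h , 2 * n ∸ h) ∷ (k , 2 * n ∸ h) ∷ []) →
  Σ (Special n) λ S →
    Represents (Special.τ S ⟨$⟩ʳ_) (prodT (p ∷ []))
    × Represents (Special.σ₀ S ⟨$⟩ʳ_) (prodT (σ₀Pairs n h k))
    × Represents (σ₁τ S) (ρFun n h k)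
realisations n h k _ adm p p∈ with Admissible⇒Arcs {n} {h} {k} adm
... | h₁ , u₁ , v₁ , refl , refl , refl =
  realisation (split (subst (λ x → p ∈ (h , k) ∷ (h , x) ∷ (k , x) ∷ []) N∸h≡e p∈))
  where
  open Arcs h₁ u₁ v₁ using (N∸h≡e)
  open Construction h₁ u₁ v₁

-- Special 4-tuples with a 3-cycle

SpecialShape : (n : ℕ) → Special n → ℕ → ℕ → Set
SpecialShape n S h k =
  Admissible n h k
  × Represents (Special.σ₀ S ⟨$⟩ʳ_) (prodT (σ₀Pairs n h k))
  × Represents (σ₁τ S) (ρFun n h k)
  × (∀ x → (σ₁τ S x ≡ x) ⇔ (label x ≡ 2 * n ⊎ label x ≡ (k + h) / 2 ⊎ label x ≡ (2 * n ∸ h + k) / 2))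

module _ (h₁ u₁ v₁ : ℕ) (S : Special (Arcs.n h₁ u₁ v₁)) where
  open Arcs h₁ u₁ v₁

  shape-from-chords : ∀ {s r : ℕ → ℕ} → Represents (Special.σ₀ S ⟨$⟩ʳ_) s → (∀ x → label (σ₁τ S x) ≡ r (label x)) →
    (∀ {w} → 1 ≤ w → w < N → r w ≡ s (suc w)) → r N ≡ N → Chords N h k e s → SpecialShape n S h k
  shape-from-chords {s} {r} rep₀ label-σ₁τ r-shift rN≡N chords = admissible , rep-σ₀ , rep-σ₁τ , fixed-points
    where
    rep-σ₀ : Represents (Special.σ₀ S ⟨$⟩ʳ_) (prodT (σ₀Pairs n h k))
    rep-σ₀ x = trans (rep₀ x) (trans (Chords-unique chords σ₀Blocks-chords (label∈ x))
                                     (cong (λ ps → prodT ps (label x)) (sym σ₀Pairs≡σ₀Blocks)))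
    r≡ρFun : ∀ {y} → InRange N y → r y ≡ ρFun n h k y
    r≡ρFun (1≤y , y≤N) with m≤n⇒m<n∨m≡n y≤N
    ... | inj₁ y<N = trans (r-shift 1≤y y<N) (sym (ρFun-shift chords 1≤y y<N))
    ... | inj₂ refl = trans rN≡N (sym ρFun-N)
    rep-σ₁τ : Represents (σ₁τ S) (ρFun n h k)
    rep-σ₁τ x = trans (label-σ₁τ x) (r≡ρFun (label∈ x))
    r-fixed : ∀ {y} → InRange N y → r y ≡ y ⇔ (y ≡ N ⊎ y ≡ h + u ⊎ y ≡ k + v)
    r-fixed (1≤y , y≤N) with m≤n⇒m<n∨m≡n y≤N
    ... | inj₂ refl = mk⇔ (λ _ → inj₁ refl) (λ _ → rN≡N)
    ... | inj₁ y<N = mk⇔ (inj₂ ∘′ Equivalence.to F ∘′ trans (sym (r-shift 1≤y y<N)))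
                         [ ⊥-elim ∘′ <⇒≢ y<N , trans (r-shift 1≤y y<N) ∘′ Equivalence.from F ]′
      where F = shift-fixed chords y<N
    fixed-points : ∀ x → (σ₁τ S x ≡ x) ⇔ (label x ≡ N ⊎ label x ≡ (k + h) / 2 ⊎ label x ≡ (N ∸ h + k) / 2)
    fixed-points x = mk⇔
      (Data.Sum.map₂ (Data.Sum.map (λ y≡ → trans y≡ (sym [k+h]/2≡h+u)) (λ y≡ → trans y≡ (sym [N∸h+k]/2≡k+v)))
        ∘′ Equivalence.to R ∘′ trans (sym (label-σ₁τ x)) ∘′ cong label)
      (label-injective ∘′ trans (label-σ₁τ x) ∘′ Equivalence.from R
        ∘′ Data.Sum.map₂ (Data.Sum.map (λ y≡ → trans y≡ [k+h]/2≡h+u) (λ y≡ → trans y≡ [N∸h+k]/2≡k+v)))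
      where R = r-fixed (label∈ x)

shape-from-chords′ : ∀ {n} (S : Special n) h₁ u₁ v₁ → n ≡ Arcs.n h₁ u₁ v₁ → ∀ {s r : ℕ → ℕ} →
  Represents (Special.σ₀ S ⟨$⟩ʳ_) s → (∀ x → label (σ₁τ S x) ≡ r (label x)) →
  (∀ {w} → 1 ≤ w → w < 2 * n → r w ≡ s (suc w)) → r (2 * n) ≡ 2 * n →
  Chords (2 * n) (suc h₁) (Arcs.k h₁ u₁ v₁) (Arcs.e h₁ u₁ v₁) s → SpecialShape n S (suc h₁) (Arcs.k h₁ u₁ v₁)
shape-from-chords′ S h₁ u₁ v₁ refl = shape-from-chords h₁ u₁ v₁ S

transposition-form : ∀ {m} {τ : Permutation′ m} → IsProdDisjTransp m 1 τ → ∃[ p ] ∃[ q ] Represents (τ ⟨$⟩ʳ_) (swapℕ p q)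
transposition-form ([] , () , _)
transposition-form ((p , q) ∷ [] , _ , _ , _ , rep) = p , q , rep
transposition-form (_ ∷ _ ∷ _ , () , _)

module SpecialOnLabels {n : ℕ} (S : Special n) (2≤n : 2 ≤ n) {ps₀ ps₁ : List (ℕ × ℕ)} {p q : ℕ}
  (uniq₀ : Unique (entries ps₀)) (ps₀∈ : All (InRange (2 * n)) (entries ps₀)) (len₀ : length ps₀ ≡ n)
  (rep₀ : Represents (Special.σ₀ S ⟨$⟩ʳ_) (prodT ps₀))
  (uniq₁ : Unique (entries ps₁)) (rep₁ : Represents (Special.σ₁ S ⟨$⟩ʳ_) (prodT ps₁))
  (repτ : Represents (Special.τ S ⟨$⟩ʳ_) (swapℕ p q)) where

  open Special S

  N : ℕ
  N = 2 * n

  s : ℕ → ℕ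
  s = prodT ps₀

  r : ℕ → ℕ
  r y = swapℕ p q (prodT ps₁ y)

  label-σ₁τ : ∀ x → label (σ₁τ S x) ≡ r (label x)
  label-σ₁τ x = trans (repτ (σ₁ ⟨$⟩ʳ x)) (cong (swapℕ p q) (rep₁ x))

  s-involutive : ∀ y → s (s y) ≡ y
  s-involutive = prodT-involutive ps₀ uniq₀

  s-range : Preserves N s
  s-range = prodT-preserves ps₀ uniq₀ ps₀∈

  s-fixedPointFree : ∀ {y} → InRange N y → s y ≢ y
  s-fixedPointFree y∈ = prodT-moves ps₀ uniq₀ (Unique-full uniq₀ ps₀∈ (trans (length-entries ps₀) (cong (2 *_) len₀)) y∈)

  relation-on-labels : ∀ {y} → InRange N y → r (rot N (s y)) ≡ y
  relation-on-labels {y} y∈ = begin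
    r (rot N (s y))                                 ≡⟨ cong (λ z → r (rot N z)) (trans (cong s (sym (label-toFin y∈))) (sym (rep₀ x))) ⟩
    r (rot N (label (σ₀ ⟨$⟩ʳ x)))                   ≡⟨ cong r (sym (σ∞-def (σ₀ ⟨$⟩ʳ x))) ⟩
    r (label (σ∞ ⟨$⟩ʳ (σ₀ ⟨$⟩ʳ x)))                 ≡⟨ sym (label-σ₁τ _) ⟩
    label (τ ⟨$⟩ʳ (σ₁ ⟨$⟩ʳ (σ∞ ⟨$⟩ʳ (σ₀ ⟨$⟩ʳ x))))  ≡⟨ cong label (relation x) ⟩
    label x                                         ≡⟨ label-toFin y∈ ⟩
    y                                               ∎
    where
    open ≡-Reasoning
    x = toFin y∈

  r-shift : ∀ {w} → 1 ≤ w → w < N → r w ≡ s (suc w)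
  r-shift {suc j} _ w<N =
    trans (cong (λ z → r (rot N z)) (sym (s-involutive (suc (suc j))))) (relation-on-labels (s-range (s≤s z≤n , w<N)))

  1≤N : 1 ≤ N
  1≤N = ≤-trans (≤-trans (s≤s z≤n) 2≤n) (m≤m+n n (n + 0))

  rN≡N : r N ≡ N
  rN≡N = trans (sym (trans (label-σ₁τ xN) (cong r lN))) (τ-fix (σ₁ ⟨$⟩ʳ xN) (σ₁-fix xN lN))
    where
    xN = toFin (1≤N , ≤-refl)
    lN = label-toFin (1≤N , ≤-refl)

  s1≡N : s 1 ≡ N
  s1≡N = trans (trans (sym (relation-on-labels (s-range (≤-refl , 1≤N)))) (cong (λ z → r (rot N z)) (s-involutive 1))) rN≡N

  module _ {a b c} (a≢b : a ≢ b) (b≢c : b ≢ c) (a≢c : a ≢ c)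
    (σa≡b : σ₁τ S a ≡ b) (σb≡c : σ₁τ S b ≡ c) (σc≡a : σ₁τ S c ≡ a) where

    ra≡b : r (label a) ≡ label b
    ra≡b = trans (sym (label-σ₁τ a)) (cong label σa≡b)

    rra≡c : r (r (label a)) ≡ label c
    rra≡c = trans (cong r ra≡b) (trans (sym (label-σ₁τ b)) (cong label σb≡c))

    cycle : ThreeCycle r (label a)
    cycle = record
      { a≢ra = λ eq → a≢b (label-injective (trans eq ra≡b))
      ; ra≢rra = λ eq → b≢c (label-injective (trans (sym ra≡b) (trans eq rra≡c)))
      ; a≢rra = λ eq → a≢c (label-injective (trans eq rra≡c))
      ; r³a≡a = trans (cong r rra≡c) (trans (sym (label-σ₁τ c)) (cong label σc≡a)) }

    on-cycle-range : ∀ {w} → OnCycle r (label a) w → InRange N w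
    on-cycle-range (inj₁ refl) = label∈ a
    on-cycle-range (inj₂ (inj₁ refl)) = subst (InRange N) (sym ra≡b) (label∈ b)
    on-cycle-range (inj₂ (inj₂ refl)) = subst (InRange N) (sym rra≡c) (label∈ c)

    top = rotate-cycle cycle (cycle-max-on r (label a))

    shape : ∃[ h ] ∃[ u ] ∃[ v ]
      (1 ≤ h × 1 ≤ u × 1 ≤ v × N ≡ 2 * (h + u + v) × Chords N h (h + 2 * u) (h + 2 * u + 2 * v) s)
    shape = ShiftedInvolution.shape s-involutive s-range s-fixedPointFree r-shift s1≡N rN≡N
      (proj₁ top) (on-cycle-range (cycle-max-on r (label a))) (cycle-max-bound r (label a) ∘′ proj₁ (proj₂ top))
      (λ w∉ → off-cycle-involutive (prodT ps₁) (prodT-involutive ps₁ uniq₁) p q cycle (w∉ ∘′ proj₂ (proj₂ top)))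

special-3cycle-shape : (n : ℕ) → 2 ≤ n → (S : Special n) → Has3Cycle (σ₁τ S) → ∃[ h ] ∃[ k ] SpecialShape n S h k
special-3cycle-shape n 2≤n S (_ , _ , _ , a≢b , b≢c , a≢c , σa≡b , σb≡c , σc≡a)
  with Special.σ₀-type S | Special.σ₁-type S | transposition-form {τ = Special.τ S} (Special.τ-type S)
... | ps₀ , len₀ , ps₀∈ , uniq₀ , rep₀ | ps₁ , _ , _ , uniq₁ , rep₁ | p , q , repτ =
  finish (shape a≢b b≢c a≢c σa≡b σb≡c σc≡a)
  where
  open SpecialOnLabels S 2≤n {ps₀} {ps₁} {p} {q} uniq₀ ps₀∈ len₀ rep₀ uniq₁ rep₁ repτ
  finish : ∃[ h ] ∃[ u ] ∃[ v ]
    (1 ≤ h × 1 ≤ u × 1 ≤ v × N ≡ 2 * (h + u + v) × Chords N h (h + 2 * u) (h + 2 * u + 2 * v) s) →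
    ∃[ h ] ∃[ k ] SpecialShape n S h k
  finish (suc h₁ , suc u₁ , suc v₁ , _ , _ , _ , N≡ , chords) =
    suc h₁ , Arcs.k h₁ u₁ v₁ , shape-from-chords′ S h₁ u₁ v₁ (*-cancelˡ-≡ n _ 2 N≡) rep₀ label-σ₁τ r-shift rN≡N chords

proposition8p2 :
    ((n : ℕ) → 2 ≤ n → (S : Special n) → Has3Cycle (σ₁τ S) →
      ∃[ h ] ∃[ k ]
        (Admissible n h k
        × Represents (Special.σ₀ S ⟨$⟩ʳ_) (prodT (σ₀Pairs n h k))
        × Represents (σ₁τ S) (ρFun n h k)
        × (∀ x → (σ₁τ S x ≡ x) ⇔
             (label x ≡ 2 * n ⊎ label x ≡ (k + h) / 2 ⊎ label x ≡ (2 * n ∸ h + k) / 2))))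
    × ((n h k : ℕ) → 2 ≤ n → Admissible n h k →
      (p : ℕ × ℕ) → p ∈ ((h , k) ∷ (h , 2 * n ∸ h) ∷ (k , 2 * n ∸ h) ∷ []) →
      Σ (Special n) λ S →
        Represents (Special.τ S ⟨$⟩ʳ_) (prodT (p ∷ []))
        × Represents (Special.σ₀ S ⟨$⟩ʳ_) (prodT (σ₀Pairs n h k))
        × Represents (σ₁τ S) (ρFun n h k))
proposition8p2 = special-3cycle-shape , realisations
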